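{- For all integers $n,k\geq 0$, $$A_{n+k,k}=\frac{1}{e}\sum_{m=0}^{\infty}\frac{m^k(m-1)^{n}}{m!}.$$
   Context: A partition of a finite set is a collection of nonempty, pairwise disjoint subsets (blocks) whose union is the set; a singleton of a partition is a block with exactly one element, and the element $i$ is called a singleton if $\{i\}$ is a block. For integers $0\leq k\leq n$, $A_{n,k}$ denotes the number of partitions of $\{1,2,\dots,n+1\}$ whose largest singleton is $k+1$ (i.e. $\{k+1\}$ is a block and no $j>k+1$ forms a singleton block). The convention $0^0=1$ is used. -}

module Defs where

open import Data.Bool using (Bool; true; false; _∧_; not; if_then_else_)
open import Data.Bool.Properties using () renaming (_≟_ to _≟ᴮ_)
open import Data.Nat as ℕ using (ℕ; zero; suc; _!; _≡ᵇ_; _<ᵇ_)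
open import Data.Nat.Properties using (_!≢0)
open import Data.Fin using (Fin; toℕ)
open import Data.Integer as ℤ using (ℤ; +_)
open import Data.Rational as ℚ using (ℚ; _/_; 0ℚ)
open import Data.List using (List; []; _∷_; map; concatMap; filter; length; allFin)
open import Data.Bool.ListAction using (all; any)
open import Relation.Nullary.Decidable using (does)
open import Relation.Binary.PropositionalEquality using (_≡_)

-- Partitions of a finite set Fin m, represented (as usual) by their
-- associated equivalence relation "i and j lie in the same block",
-- given as a Boolean matrix.  Blocks = equivalence classes.

BRel : ℕ → Set
BRel m = Fin m → Fin m → Bool

allFuns : {A : Set} → List A → (n : ℕ) → List (Fin n → A)
allFuns xs zero    = (λ ()) ∷ []
allFuns xs (suc n) =
  concatMap (λ x → map (λ f → λ { Fin.zero → x ; (Fin.suc i) → f i }) (allFuns xs n)) xs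

allBRels : (m : ℕ) → List (BRel m)
allBRels m = allFuns (allFuns (false ∷ true ∷ []) m) m

_⇒ᵇ_ : Bool → Bool → Bool
a ⇒ᵇ b = not a Data.Bool.∨ b

isEquivᵇ : {m : ℕ} → BRel m → Bool
isEquivᵇ {m} R =
  all (λ i → R i i) (allFin m) ∧
  all (λ i → all (λ j → R i j ⇒ᵇ R j i) (allFin m)) (allFin m) ∧
  all (λ i → all (λ j → all (λ l → (R i j ∧ R j l) ⇒ᵇ R i l) (allFin m)) (allFin m)) (allFin m)

isSingletonᵇ : {m : ℕ} → BRel m → Fin m → Bool
isSingletonᵇ {m} R i = all (λ j → does (R i j ≟ᴮ (toℕ j ≡ᵇ toℕ i))) (allFin m)

largestSingletonIsᵇ : {m : ℕ} → BRel m → ℕ → Bool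
largestSingletonIsᵇ {m} R k =
  any (λ i → (toℕ i ≡ᵇ k) ∧ isSingletonᵇ R i) (allFin m) ∧
  all (λ i → (k <ᵇ toℕ i) ⇒ᵇ not (isSingletonᵇ R i)) (allFin m)

-- A n k : number of partitions of {1,…,n+1} whose largest singleton is k+1.
-- Element t ∈ {1,…,n+1} is encoded as index t-1 ∈ Fin (n+1), so k+1 ↦ index k.
A : ℕ → ℕ → ℕ
A n k = length (filter (λ R → isEquivᵇ R ∧ largestSingletonIsᵇ R k ≟ᴮ true) (allBRels (suc n)))

Σ< : ℕ → (ℕ → ℚ) → ℚ
Σ< zero    f = 0ℚ
Σ< (suc N) f = Σ< N f ℚ.+ f N

-- term m^k (m-1)^n / m!   (with 0^0 = 1; (m-1) computed in ℤ)
term : ℕ → ℕ → ℕ → ℚ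
term n k m = ((+ m) ℤ.^ k ℤ.* ((+ m) ℤ.- + 1) ℤ.^ n) / (m !) where instance _ = m !≢0

invFact : ℕ → ℚ
invFact m = + 1 / (m !) where instance _ = m !≢0

module Submission where

-- Write E(k, n) for the number of partitions of an (n + k)-element set in which none of the last n
-- elements is a singleton. Moving the singleton k + 1 to the front and deleting it shows
-- A(n + k, k) = E(k, n); splitting on whether element k is a singleton gives
-- E(k + 1, n) = E(k, n) + E(k, n + 1); and E(k, 0) is the Bell number ∑ⱼ S(k, j).
--
-- The polynomials m^k (m - 1)^n satisfy the same recursion in (k, n). Starting from
-- m^k = ∑ⱼ S(k, j) m⁽ʲ⁾ (falling factorials), this gives m^k (m - 1)^n = ∑ⱼ cⱼ m⁽ʲ⁾ with integers cⱼ,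
-- j ≤ n + k, whose sum is E(k, n). Since ∑ₘ m⁽ʲ⁾ / m! = ∑ₘ 1 / m! = e for every j, the series is
-- E(k, n) · e. Truncated at N, the error is ∑ⱼ cⱼ (∑_{m<N-j} - ∑_{m<N}) 1/m!, which is at most
-- (∑ⱼ |cⱼ|) · (n + k + 1) / (N - n - k - 1)! and hence eventually below any ε > 0.

open import Algebra.Bundles using (CommutativeSemiring; CommutativeRing)
open import Defs

module RangeSum {c ℓ} (R : CommutativeSemiring c ℓ) where

  open import Data.Nat as ℕ using (ℕ; zero; suc; _≤_; _∸_)
  import Data.Nat.Properties as ℕₚ
  open import Function using (_∘_)
  import Relation.Binary.PropositionalEquality as ≡

  open CommutativeSemiring R
  open import Algebra.Properties.CommutativeSemigroup +-commutativeSemigroup using (interchange)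
  open import Relation.Binary.Reasoning.Setoid setoid

  ∑< : ℕ → (ℕ → Carrier) → Carrier
  ∑< zero    f = 0#
  ∑< (suc B) f = f 0 + ∑< B (f ∘ suc)

  syntax ∑< B (λ j → f) = ∑[ j < B ] f

  ∑-cong : ∀ B {f g : ℕ → Carrier} → (∀ j → j ℕ.< B → f j ≈ g j) → ∑< B f ≈ ∑< B g
  ∑-cong zero    f≈g = refl
  ∑-cong (suc B) f≈g = +-cong (f≈g 0 ℕ.z<s) (∑-cong B (λ j j<B → f≈g (suc j) (ℕ.s<s j<B)))

  ∑-zero : ∀ B {f : ℕ → Carrier} → (∀ j → j ℕ.< B → f j ≈ 0#) → ∑< B f ≈ 0#
  ∑-zero B f≈0 = trans (∑-cong B f≈0) (zeros B)
    where
    zeros : ∀ B → ∑[ j < B ] 0# ≈ 0#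
    zeros zero    = refl
    zeros (suc B) = trans (+-identityˡ _) (zeros B)

  ∑-distrib-+ : ∀ B (f g : ℕ → Carrier) → ∑[ j < B ] (f j + g j) ≈ ∑< B f + ∑< B g
  ∑-distrib-+ zero    f g = sym (+-identityˡ 0#)
  ∑-distrib-+ (suc B) f g = begin
    f 0 + g 0 + ∑[ j < B ] (f (suc j) + g (suc j))  ≈⟨ +-congˡ (∑-distrib-+ B (f ∘ suc) (g ∘ suc)) ⟩
    f 0 + g 0 + (∑< B (f ∘ suc) + ∑< B (g ∘ suc))   ≈⟨ interchange _ _ _ _ ⟩
    ∑< (suc B) f + ∑< (suc B) g                       ∎

  ∑-distribˡ-* : ∀ B x (f : ℕ → Carrier) → x * ∑< B f ≈ ∑[ j < B ] (x * f j)
  ∑-distribˡ-* zero    x f = zeroʳ x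
  ∑-distribˡ-* (suc B) x f = trans (distribˡ x _ _) (+-congˡ (∑-distribˡ-* B x (f ∘ suc)))

  ∑-distribʳ-* : ∀ B x (f : ℕ → Carrier) → ∑< B f * x ≈ ∑[ j < B ] (f j * x)
  ∑-distribʳ-* B x f = trans (*-comm _ x) (trans (∑-distribˡ-* B x f) (∑-cong B (λ j _ → *-comm x (f j))))

  ∑-comm : ∀ B C (f : ℕ → ℕ → Carrier) → ∑[ i < B ] ∑[ j < C ] f i j ≈ ∑[ j < C ] ∑[ i < B ] f i j
  ∑-comm zero    C f = sym (∑-zero C (λ _ _ → refl))
  ∑-comm (suc B) C f = begin
    ∑< C (f 0) + ∑[ i < B ] ∑[ j < C ] f (suc i) j  ≈⟨ +-congˡ (∑-comm B C (f ∘ suc)) ⟩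
    ∑< C (f 0) + ∑[ j < C ] ∑[ i < B ] f (suc i) j  ≈⟨ sym (∑-distrib-+ C (f 0) _) ⟩
    ∑[ j < C ] ∑[ i < suc B ] f i j                  ∎

  ∑-split : ∀ B C (f : ℕ → Carrier) → ∑< (B ℕ.+ C) f ≈ ∑< B f + ∑[ j < C ] f (B ℕ.+ j)
  ∑-split zero    C f = sym (+-identityˡ _)
  ∑-split (suc B) C f = trans (+-congˡ (∑-split B C (f ∘ suc))) (sym (+-assoc _ _ _))

  ∑-last : ∀ B (f : ℕ → Carrier) → ∑< (suc B) f ≈ ∑< B f + f B
  ∑-last B f = begin
    ∑< (suc B) f                     ≡⟨ ≡.cong (λ n → ∑< n f) (ℕₚ.+-comm B 1) ⟨
    ∑< (B ℕ.+ 1) f                   ≈⟨ ∑-split B 1 f ⟩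
    ∑< B f + (f (B ℕ.+ 0) + 0#)      ≈⟨ +-congˡ (+-identityʳ _) ⟩
    ∑< B f + f (B ℕ.+ 0)             ≡⟨ ≡.cong (λ n → ∑< B f + f n) (ℕₚ.+-identityʳ B) ⟩
    ∑< B f + f B                     ∎

  ∑-extend : ∀ {B B'} (f : ℕ → Carrier) → B ≤ B' → (∀ j → f (B ℕ.+ j) ≈ 0#) → ∑< B' f ≈ ∑< B f
  ∑-extend {B} {B'} f B≤B' vanish = begin
    ∑< B' f                                ≡⟨ ≡.cong (λ n → ∑< n f) (ℕₚ.m+[n∸m]≡n B≤B') ⟨
    ∑< (B ℕ.+ (B' ∸ B)) f                  ≈⟨ ∑-split B (B' ∸ B) f ⟩
    ∑< B f + ∑[ j < B' ∸ B ] f (B ℕ.+ j)   ≈⟨ +-congˡ (∑-zero (B' ∸ B) (λ j _ → vanish j)) ⟩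
    ∑< B f + 0#                            ≈⟨ +-identityʳ _ ⟩
    ∑< B f                                 ∎

module RangeSumRing {c ℓ} (R : CommutativeRing c ℓ) where

  open import Data.Nat using (ℕ; zero; suc)
  open import Function using (_∘_)

  open CommutativeRing R
  open import Algebra.Properties.Ring ring using (-0#≈0#)
  open import Algebra.Properties.AbelianGroup +-abelianGroup using (⁻¹-∙-comm)
  open RangeSum commutativeSemiring public

  ∑-neg : ∀ B (f : ℕ → Carrier) → ∑[ j < B ] (- f j) ≈ - ∑< B f
  ∑-neg zero    f = sym -0#≈0#
  ∑-neg (suc B) f = trans (+-congˡ (∑-neg B (f ∘ suc))) (⁻¹-∙-comm _ _)

  ∑-distrib-- : ∀ B (f g : ℕ → Carrier) → ∑[ j < B ] (f j - g j) ≈ ∑< B f - ∑< B g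
  ∑-distrib-- B f g = trans (∑-distrib-+ B f (-_ ∘ g)) (+-congˡ (∑-neg B g))

module Combinatorics where

  open import Data.Bool using (Bool; true; false; _∧_; not; T; if_then_else_)
  open import Data.Bool.Properties using (T-≡; ∧-zeroʳ; ∧-identityʳ) renaming (_≟_ to _≟ᴮ_)
  open import Data.Bool.ListAction using (all; any)
  open import Data.Nat as ℕ using (ℕ; zero; suc; _+_; _*_; _^_; _∸_; _≤_; _<_; _<?_; _≤?_; _≡ᵇ_; z≤n; s≤s)
  import Data.Nat.Properties as ℕₚ
  open import Algebra.Properties.CommutativeSemigroup ℕₚ.+-commutativeSemigroup using (interchange)
  open import Data.Nat.Properties using
    (+-assoc; +-identityʳ; *-comm; *-zeroʳ; *-identityʳ; *-distribˡ-+; suc-injective; m≤n⇒m≤1+n; m<n⇒m<1+n;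
     n<1+n; <-cmp; ≤⇒≯; <⇒≤; <-irrefl; m≤n+m; +-suc; m≤n⇒m∸n≡0; m∸n+n≡m; ≰⇒>)
  open import Data.Nat.Combinatorics.Base using (_P′_)
  open import Data.Nat.Tactic.RingSolver using (solve-∀)
  open import Data.Fin using (Fin; zero; suc; toℕ; fromℕ<)
  open import Data.Fin.Properties using (_≟_; toℕ-injective; toℕ-fromℕ<; toℕ<n)
  open import Data.Fin.Permutation using (Permutation; _⟨$⟩ʳ_; _⟨$⟩ˡ_; inverseˡ; inverseʳ)
  import Data.Fin.Permutation as Perm
  open import Data.Fin.Permutation.Components using (transpose)
  open import Data.List using (List; []; _∷_; _++_; map; concatMap; filter; length; allFin; tabulate)
  import Data.List.Relation.Unary.All.Properties as All
  import Data.List.Relation.Unary.Any.Properties as Any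
  open import Data.Maybe using (Maybe; nothing; just)
  open import Data.Maybe.Properties using (≡-dec)
  open import Data.Product using (_×_; _,_; proj₁; proj₂; ∃)
  open import Data.Vec.Functional using (updateAt) renaming (_∷_ to _◂_)
  open import Data.Vec.Functional.Properties using (updateAt-updates; updateAt-minimal)
  open import Function using (_∘_; Equivalence)
  open import Relation.Binary.Definitions using (tri<; tri≈; tri>)
  open import Relation.Binary.Structures using (IsEquivalence)
  open import Relation.Binary.PropositionalEquality hiding (isEquivalence)
  import Relation.Binary.PropositionalEquality as ≡
  open import Relation.Nullary using (Dec; yes; no; does; _×-dec_; map′; contradiction)
  open import Relation.Nullary.Decidable using (dec-true; dec-false)

  open RangeSum ℕₚ.+-*-commutativeSemiring
  open ≡-Reasoning

  ∧-elim : ∀ {a b} → a ∧ b ≡ true → a ≡ true × b ≡ true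
  ∧-elim {true} {true} _ = refl , refl

  ∧-intro : ∀ {a b} → a ≡ true → b ≡ true → a ∧ b ≡ true
  ∧-intro refl refl = refl

  bool-ext : ∀ {a b} → (a ≡ true → b ≡ true) → (b ≡ true → a ≡ true) → a ≡ b
  bool-ext {true}  {true}  _ _ = refl
  bool-ext {true}  {false} f _ = sym (f refl)
  bool-ext {false} {true}  _ g = g refl
  bool-ext {false} {false} _ _ = refl

  does-sound : ∀ {p} {P : Set p} (P? : Dec P) → does P? ≡ true → P
  does-sound (yes p) _ = p

  indicator : Bool → ℕ
  indicator true  = 1
  indicator false = 0

  indicator-∧ : ∀ a b → indicator (a ∧ b) ≡ indicator a * indicator b
  indicator-∧ true  b = sym (+-identityʳ (indicator b))
  indicator-∧ false b = refl

  sumOver : {A : Set} → List A → (A → ℕ) → ℕ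
  sumOver []       f = 0
  sumOver (x ∷ xs) f = f x + sumOver xs f

  count : {A : Set} → (A → Bool) → List A → ℕ
  count p xs = sumOver xs (indicator ∘ p)

  length-filter≡count : {A : Set} (p : A → Bool) (xs : List A) →
    length (filter (λ x → p x ≟ᴮ true) xs) ≡ count p xs
  length-filter≡count p []       = refl
  length-filter≡count p (x ∷ xs) with p x
  ... | true  = cong suc (length-filter≡count p xs)
  ... | false = length-filter≡count p xs

  module _ {A : Set} where

    sumOver-cong : (xs : List A) {f g : A → ℕ} → (∀ x → f x ≡ g x) → sumOver xs f ≡ sumOver xs g
    sumOver-cong []       f≡g = refl
    sumOver-cong (x ∷ xs) f≡g = cong₂ _+_ (f≡g x) (sumOver-cong xs f≡g)

    sumOver-zero : (xs : List A) {f : A → ℕ} → (∀ x → f x ≡ 0) → sumOver xs f ≡ 0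
    sumOver-zero []       f≡0 = refl
    sumOver-zero (x ∷ xs) f≡0 = cong₂ _+_ (f≡0 x) (sumOver-zero xs f≡0)

    sumOver-distrib-+ : (xs : List A) (f g : A → ℕ) →
      sumOver xs (λ x → f x + g x) ≡ sumOver xs f + sumOver xs g
    sumOver-distrib-+ []       f g = refl
    sumOver-distrib-+ (x ∷ xs) f g =
      trans (cong (f x + g x +_) (sumOver-distrib-+ xs f g)) (interchange (f x) (g x) _ _)

    sumOver-distribˡ-* : (xs : List A) (c : ℕ) (f : A → ℕ) →
      sumOver xs (λ x → c * f x) ≡ c * sumOver xs f
    sumOver-distribˡ-* []       c f = sym (*-zeroʳ c)
    sumOver-distribˡ-* (x ∷ xs) c f =
      trans (cong (c * f x +_) (sumOver-distribˡ-* xs c f)) (sym (*-distribˡ-+ c (f x) _))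

    sumOver-distribʳ-* : (xs : List A) (c : ℕ) (f : A → ℕ) →
      sumOver xs (λ x → f x * c) ≡ sumOver xs f * c
    sumOver-distribʳ-* xs c f =
      trans (sumOver-cong xs (λ x → *-comm (f x) c)) (trans (sumOver-distribˡ-* xs c f) (*-comm c _))

    sumOver-++ : (xs ys : List A) (f : A → ℕ) → sumOver (xs ++ ys) f ≡ sumOver xs f + sumOver ys f
    sumOver-++ []       ys f = refl
    sumOver-++ (x ∷ xs) ys f = trans (cong (f x +_) (sumOver-++ xs ys f)) (sym (+-assoc (f x) _ _))

    count-cong : (xs : List A) {p q : A → Bool} → (∀ x → p x ≡ q x) → count p xs ≡ count q xs
    count-cong xs p≡q = sumOver-cong xs (cong indicator ∘ p≡q)

    count-none : (xs : List A) {p : A → Bool} → (∀ x → p x ≡ false) → count p xs ≡ 0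
    count-none xs p≡false = sumOver-zero xs (cong indicator ∘ p≡false)

    count-split : (xs : List A) (p q : A → Bool) →
      count p xs ≡ count (λ x → p x ∧ q x) xs + count (λ x → p x ∧ not (q x)) xs
    count-split xs p q = trans (sumOver-cong xs split) (sumOver-distrib-+ xs _ _)
      where
      split : ∀ x → indicator (p x) ≡ indicator (p x ∧ q x) + indicator (p x ∧ not (q x))
      split x with p x | q x
      ... | true  | true  = refl
      ... | true  | false = refl
      ... | false | _     = refl

  module _ {A B : Set} where

    sumOver-map : (xs : List A) (h : A → B) (f : B → ℕ) → sumOver (map h xs) f ≡ sumOver xs (f ∘ h)
    sumOver-map []       h f = refl
    sumOver-map (x ∷ xs) h f = cong (f (h x) +_) (sumOver-map xs h f)

    sumOver-concatMap : (xs : List A) (h : A → List B) (f : B → ℕ) →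
      sumOver (concatMap h xs) f ≡ sumOver xs (λ x → sumOver (h x) f)
    sumOver-concatMap []       h f = refl
    sumOver-concatMap (x ∷ xs) h f =
      trans (sumOver-++ (h x) (concatMap h xs) f) (cong (sumOver (h x) f +_) (sumOver-concatMap xs h f))

    sumOver-comm : (xs : List A) (ys : List B) (f : A → B → ℕ) →
      sumOver xs (λ x → sumOver ys (f x)) ≡ sumOver ys (λ y → sumOver xs (λ x → f x y))
    sumOver-comm []       ys f = sym (sumOver-zero ys (λ _ → refl))
    sumOver-comm (x ∷ xs) ys f =
      trans (cong (sumOver ys (f x) +_) (sumOver-comm xs ys f)) (sym (sumOver-distrib-+ ys (f x) _))

    double-counting : (xs : List A) (ys : List B) (p : A → Bool) (q : B → Bool) (r : A → B → Bool) →
      (∀ x → indicator (p x) ≡ count (r x) ys) → (∀ y → indicator (q y) ≡ count (λ x → r x y) xs) →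
      count p xs ≡ count q ys
    double-counting xs ys p q r row col = begin
      count p xs                                                 ≡⟨ sumOver-cong xs row ⟩
      sumOver xs (λ x → sumOver ys (λ y → indicator (r x y)))    ≡⟨ sumOver-comm xs ys _ ⟩
      sumOver ys (λ y → sumOver xs (λ x → indicator (r x y)))    ≡⟨ sumOver-cong ys col ⟨
      count q ys                                                 ∎

  count-pairs : {A B C : Set} (xs : List A) (ys : List B) (g : A → B → C) (p : A → Bool)
    (q : B → Bool) (r : C → Bool) →
    (∀ x y → r (g x y) ≡ p x ∧ q y) → count r (concatMap (λ x → map (g x) ys) xs) ≡ count p xs * count q ys
  count-pairs xs ys g p q r r≡p∧q = begin
    count r (concatMap (λ x → map (g x) ys) xs)
      ≡⟨ sumOver-concatMap xs _ _ ⟩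
    sumOver xs (λ x → count r (map (g x) ys))
      ≡⟨ sumOver-cong xs (λ x → sumOver-map ys (g x) _) ⟩
    sumOver xs (λ x → sumOver ys (λ y → indicator (r (g x y))))
      ≡⟨ sumOver-cong xs (λ x → sumOver-cong ys
          (λ y → trans (cong indicator (r≡p∧q x y)) (indicator-∧ (p x) (q y)))) ⟩
    sumOver xs (λ x → sumOver ys (λ y → indicator (p x) * indicator (q y)))
      ≡⟨ sumOver-cong xs (λ x → sumOver-distribˡ-* ys (indicator (p x)) (indicator ∘ q)) ⟩
    sumOver xs (λ x → indicator (p x) * count q ys)
      ≡⟨ sumOver-distribʳ-* xs (count q ys) (indicator ∘ p) ⟩
    count p xs * count q ys ∎

  -- Counting along bijections

  record Enumeration (A : Set) : Set₁ where
    field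
      _≈_           : A → A → Set
      isEquivalence : IsEquivalence _≈_
      _≈?_          : ∀ a b → Dec (a ≈ b)
      elements      : List A
      once          : ∀ a → count (λ b → does (a ≈? b)) elements ≡ 1

    open IsEquivalence isEquivalence public

  record Bijection {A B : Set} (EA : Enumeration A) (EB : Enumeration B) (p : A → Bool) (q : B → Bool) : Set where
    private
      module EA = Enumeration EA
      module EB = Enumeration EB
    field
      to        : A → B
      from      : B → A
      p-resp    : ∀ {a a'} → a EA.≈ a' → p a ≡ true → p a' ≡ true
      q-resp    : ∀ {b b'} → b EB.≈ b' → q b ≡ true → q b' ≡ true
      to-cong   : ∀ {a a'} → a EA.≈ a' → to a EB.≈ to a'
      from-cong : ∀ {b b'} → b EB.≈ b' → from b EA.≈ from b'
      to-q      : ∀ a → p a ≡ true → q (to a) ≡ true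
      from-p    : ∀ b → q b ≡ true → p (from b) ≡ true
      from-to   : ∀ a → p a ≡ true → from (to a) EA.≈ a
      to-from   : ∀ b → q b ≡ true → to (from b) EB.≈ b

  count-bijection : {A B : Set} (EA : Enumeration A) (EB : Enumeration B) {p : A → Bool} {q : B → Bool} →
    Bijection EA EB p q → count p (Enumeration.elements EA) ≡ count q (Enumeration.elements EB)
  count-bijection EA EB {p} {q} f =
    double-counting EA.elements EB.elements p q (λ a b → p a ∧ does (to a EB.≈? b)) row column
    where
    module EA = Enumeration EA
    module EB = Enumeration EB
    open Bijection f

    row : ∀ a → indicator (p a) ≡ count (λ b → p a ∧ does (to a EB.≈? b)) EB.elements
    row a with p a
    ... | true  = sym (EB.once (to a))
    ... | false = sym (count-none EB.elements (λ _ → refl))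

    column : ∀ b → indicator (q b) ≡ count (λ a → p a ∧ does (to a EB.≈? b)) EA.elements
    column b with q b in qb
    ... | true  = sym (trans (count-cong EA.elements preimage) (EA.once (from b)))
      where
      preimage : ∀ a → p a ∧ does (to a EB.≈? b) ≡ does (from b EA.≈? a)
      preimage a = bool-ext
        (λ h → let (pa , ab) = ∧-elim {p a} h in
          dec-true (from b EA.≈? a) (EA.trans (from-cong (EB.sym (does-sound (to a EB.≈? b) ab))) (from-to a pa)))
        (λ h → let ba = does-sound (from b EA.≈? a) h in
          ∧-intro (p-resp ba (from-p b qb)) (dec-true (to a EB.≈? b) (EB.trans (to-cong (EA.sym ba)) (to-from b qb))))
    ... | false = sym (count-none EA.elements none)
      where
      none : ∀ a → p a ∧ does (to a EB.≈? b) ≡ false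
      none a with p a in pa | to a EB.≈? b
      ... | true  | yes ab = trans (sym (q-resp ab (to-q a pa))) qb
      ... | true  | no  _  = refl
      ... | false | _      = refl

  bool-enumeration : Enumeration Bool
  bool-enumeration = record
    { _≈_ = _≡_ ; isEquivalence = ≡.isEquivalence ; _≈?_ = _≟ᴮ_
    ; elements = false ∷ true ∷ [] ; once = λ { false → refl ; true → refl } }

  pointwise? : {A : Set} {_≈_ : A → A → Set} → (∀ a b → Dec (a ≈ b)) →
    ∀ {n} (f g : Fin n → A) → Dec (∀ i → f i ≈ g i)
  pointwise? _≈?_ {zero}  f g = yes (λ ())
  pointwise? _≈?_ {suc n} f g =
    map′ (λ { (h₀ , hₛ) → λ { zero → h₀ ; (suc i) → hₛ i } }) (λ h → h zero , h ∘ suc)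
         ((f zero ≈? g zero) ×-dec pointwise? _≈?_ (f ∘ suc) (g ∘ suc))

  module _ {A : Set} (E : Enumeration A) where
    open Enumeration E using (_≈_; _≈?_; elements; once) renaming (refl to ≈-refl; sym to ≈-sym; trans to ≈-trans)

    allFuns-once : ∀ n (f : Fin n → A) → count (λ g → does (pointwise? _≈?_ f g)) (allFuns elements n) ≡ 1
    allFuns-once zero    f = refl
    allFuns-once (suc n) f = trans
      (count-pairs elements (allFuns elements n) _ (λ x → does (f zero ≈? x))
                   (λ g → does (pointwise? _≈?_ (f ∘ suc) g)) _ (λ _ _ → refl))
      (cong₂ _*_ (once (f zero)) (allFuns-once n (f ∘ suc)))

    function-enumeration : ∀ n → Enumeration (Fin n → A)
    function-enumeration n = record
      { _≈_           = λ f g → ∀ i → f i ≈ g i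
      ; isEquivalence = record
        { refl = λ i → ≈-refl ; sym = λ f≈g i → ≈-sym (f≈g i) ; trans = λ f≈g g≈h i → ≈-trans (f≈g i) (g≈h i) }
      ; _≈?_          = pointwise? _≈?_
      ; elements      = allFuns elements n
      ; once          = allFuns-once n
      }

  sumOver-tabulate : {A : Set} {n : ℕ} (f : Fin n → A) (g : A → ℕ) →
    sumOver (tabulate f) g ≡ sumOver (allFin n) (g ∘ f)
  sumOver-tabulate {n = zero}  f g = refl
  sumOver-tabulate {n = suc n} f g =
    cong (g (f zero) +_) (trans (sumOver-tabulate (f ∘ suc) g) (sym (sumOver-tabulate suc (g ∘ f))))

  sumOver-allFin-suc : {n : ℕ} (g : Fin (suc n) → ℕ) →
    sumOver (allFin (suc n)) g ≡ g zero + sumOver (allFin n) (g ∘ suc)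
  sumOver-allFin-suc g = cong (g zero +_) (sumOver-tabulate suc g)

  count-allFin-suc : {n : ℕ} (p : Fin (suc n) → Bool) →
    count p (allFin (suc n)) ≡ indicator (p zero) + count (p ∘ suc) (allFin n)
  count-allFin-suc p = sumOver-allFin-suc (indicator ∘ p)

  count-allFin≤ : {n : ℕ} (p : Fin n → Bool) → count p (allFin n) ≤ n
  count-allFin≤ {zero}  p = z≤n
  count-allFin≤ {suc n} p rewrite count-allFin-suc p with p zero
  ... | true  = s≤s (count-allFin≤ (p ∘ suc))
  ... | false = m≤n⇒m≤1+n (count-allFin≤ (p ∘ suc))

  count-≟ : {n : ℕ} (a : Fin n) → count (λ i → does (a ≟ i)) (allFin n) ≡ 1
  count-≟ {suc n} zero    = trans (count-allFin-suc {n} (λ i → does (zero ≟ i)))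
    (cong suc (count-none (allFin n) (λ _ → refl)))
  count-≟ {suc n} (suc a) = trans (count-allFin-suc {n} (λ i → does (suc a ≟ i))) (count-≟ a)

  maybe-fin-enumeration : ∀ k → Enumeration (Maybe (Fin k))
  maybe-fin-enumeration k = record
    { _≈_ = _≡_ ; isEquivalence = ≡.isEquivalence ; _≈?_ = ≡-dec _≟_
    ; elements = nothing ∷ map just (allFin k) ; once = once }
    where
    once : ∀ o → count (λ o' → does (≡-dec _≟_ o o')) (nothing ∷ map just (allFin k)) ≡ 1
    once nothing  = cong suc (trans (sumOver-map (allFin k) just _) (count-none (allFin k) (λ _ → refl)))
    once (just a) = trans (sumOver-map (allFin k) just _) (count-≟ a)

  product-enumeration : {A B : Set} → Enumeration A → Enumeration B → Enumeration (A × B)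
  product-enumeration {A} {B} EA EB = record
    { _≈_           = λ (a , b) (a' , b') → a EA.≈ a' × b EB.≈ b'
    ; isEquivalence = record
      { refl  = EA.refl , EB.refl
      ; sym   = λ (a≈ , b≈) → EA.sym a≈ , EB.sym b≈
      ; trans = λ (a≈ , b≈) (a≈' , b≈') → EA.trans a≈ a≈' , EB.trans b≈ b≈' }
    ; _≈?_          = λ (a , b) (a' , b') → (a EA.≈? a') ×-dec (b EB.≈? b')
    ; elements      = pairs
    ; once          = once
    }
    where
    module EA = Enumeration EA
    module EB = Enumeration EB
    pairs : List (A × B)
    pairs = concatMap (λ a → map (a ,_) EB.elements) EA.elements
    once : ∀ ab → count (λ (a' , b') → does (proj₁ ab EA.≈? a') ∧ does (proj₂ ab EB.≈? b')) pairs ≡ 1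
    once (a , b) = trans (count-pairs EA.elements EB.elements _,_ _ _ _ (λ _ _ → refl))
      (cong₂ _*_ (EA.once a) (EB.once b))

  private
    T⇒≡ : ∀ {b} → T b → b ≡ true
    T⇒≡ = Equivalence.to T-≡

    ≡⇒T : ∀ {b} → b ≡ true → T b
    ≡⇒T = Equivalence.from T-≡

  all-allFin⁻ : ∀ {n} {p : Fin n → Bool} → all p (allFin n) ≡ true → ∀ i → p i ≡ true
  all-allFin⁻ {n} {p} h i = T⇒≡ (All.tabulate⁻ (All.all⁺ p (allFin n) (≡⇒T h)) i)

  all-allFin⁺ : ∀ {n} {p : Fin n → Bool} → (∀ i → p i ≡ true) → all p (allFin n) ≡ true
  all-allFin⁺ {p = p} h = T⇒≡ (All.all⁻ p (All.tabulate⁺ (≡⇒T ∘ h)))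

  any-allFin⁻ : ∀ {n} {p : Fin n → Bool} → any p (allFin n) ≡ true → ∃ λ i → p i ≡ true
  any-allFin⁻ {n} {p} h = let (i , pi) = Any.tabulate⁻ (Any.any⁻ p (allFin n) (≡⇒T h)) in i , T⇒≡ pi

  any-allFin⁺ : ∀ {n} {p : Fin n → Bool} i → p i ≡ true → any p (allFin n) ≡ true
  any-allFin⁺ {p = p} i h = T⇒≡ (Any.any⁺ p (Any.tabulate⁺ i (≡⇒T h)))

  all-cong : {A : Set} (xs : List A) {p q : A → Bool} → (∀ x → p x ≡ q x) → all p xs ≡ all q xs
  all-cong []       p≡q = refl
  all-cong (x ∷ xs) p≡q = cong₂ _∧_ (p≡q x) (all-cong xs p≡q)

  ⇒ᵇ-elim : ∀ {a b} → a ⇒ᵇ b ≡ true → a ≡ true → b ≡ true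
  ⇒ᵇ-elim h refl = h

  ⇒ᵇ-intro : ∀ {a b} → (a ≡ true → b ≡ true) → a ⇒ᵇ b ≡ true
  ⇒ᵇ-intro {true}  h = h refl
  ⇒ᵇ-intro {false} h = refl

  ≡ᵇ-toℕ : ∀ {n} (i j : Fin n) → (toℕ i ≡ᵇ toℕ j) ≡ does (i ≟ j)
  ≡ᵇ-toℕ zero    zero    = refl
  ≡ᵇ-toℕ zero    (suc j) = refl
  ≡ᵇ-toℕ (suc i) zero    = refl
  ≡ᵇ-toℕ (suc i) (suc j) = ≡ᵇ-toℕ i j

  -- Its list of elements is Defs.allBRels m, definitionally.
  relation-enumeration : ∀ m → Enumeration (BRel m)
  relation-enumeration m = function-enumeration (function-enumeration bool-enumeration m) m

  module _ {m : ℕ} where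

    _≐_ : BRel m → BRel m → Set
    R ≐ S = ∀ i j → R i j ≡ S i j

    IsPartition : BRel m → Set
    IsPartition R = IsEquivalence (λ i j → R i j ≡ true)

    IsSingleton : BRel m → Fin m → Set
    IsSingleton R i = ∀ j → R i j ≡ does (j ≟ i)

    private
      reflexiveᵇ symmetricᵇ : BRel m → Bool
      reflexiveᵇ R = all (λ i → R i i) (allFin m)
      symmetricᵇ R = all (λ i → all (λ j → R i j ⇒ᵇ R j i) (allFin m)) (allFin m)

    isEquivᵇ-sound : (R : BRel m) → isEquivᵇ R ≡ true → IsPartition R
    isEquivᵇ-sound R h = record
      { refl  = λ {i} → all-allFin⁻ reflexive i
      ; sym   = λ {i} {j} → ⇒ᵇ-elim (all-allFin⁻ (all-allFin⁻ symmetric i) j)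
      ; trans = λ {i} {j} {l} Rij Rjl → ⇒ᵇ-elim
        (all-allFin⁻ (all-allFin⁻ (all-allFin⁻ transitive i) j) l) (∧-intro Rij Rjl)
      }
      where
      reflexive  = proj₁ (∧-elim {reflexiveᵇ R} h)
      symmetric  = proj₁ (∧-elim {symmetricᵇ R} (proj₂ (∧-elim {reflexiveᵇ R} h)))
      transitive = proj₂ (∧-elim {symmetricᵇ R} (proj₂ (∧-elim {reflexiveᵇ R} h)))

    isEquivᵇ-complete : (R : BRel m) → IsPartition R → isEquivᵇ R ≡ true
    isEquivᵇ-complete R E = ∧-intro {reflexiveᵇ R} (all-allFin⁺ (λ i → E.refl {i})) (∧-intro {symmetricᵇ R}
      (all-allFin⁺ (λ i → all-allFin⁺ (λ j → ⇒ᵇ-intro (E.sym {i} {j}))))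
      (all-allFin⁺ (λ i → all-allFin⁺ (λ j → all-allFin⁺ (λ l → ⇒ᵇ-intro (λ h →
        let (Rij , Rjl) = ∧-elim {R i j} h in E.trans {i} {j} {l} Rij Rjl))))))
      where module E = IsEquivalence E

    isSingletonᵇ-sound : (R : BRel m) (i : Fin m) → isSingletonᵇ R i ≡ true → IsSingleton R i
    isSingletonᵇ-sound R i h j = trans (does-sound (R i j ≟ᴮ _) (all-allFin⁻ h j)) (≡ᵇ-toℕ j i)

    isSingletonᵇ-complete : (R : BRel m) (i : Fin m) → IsSingleton R i → isSingletonᵇ R i ≡ true
    isSingletonᵇ-complete R i h = all-allFin⁺ (λ j → dec-true (R i j ≟ᴮ _) (trans (h j) (sym (≡ᵇ-toℕ j i))))

    isEquivᵇ-resp : {R S : BRel m} → R ≐ S → isEquivᵇ R ≡ isEquivᵇ S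
    isEquivᵇ-resp R≐S = cong₂ _∧_ (all-cong (allFin m) (λ i → R≐S i i))
      (cong₂ _∧_ (all-cong (allFin m) (λ i → all-cong (allFin m) (λ j → cong₂ _⇒ᵇ_ (R≐S i j) (R≐S j i))))
                 (all-cong (allFin m) (λ i → all-cong (allFin m) (λ j → all-cong (allFin m) (λ l →
                   cong₂ _⇒ᵇ_ (cong₂ _∧_ (R≐S i j) (R≐S j l)) (R≐S i l))))))

    isSingletonᵇ-resp : {R S : BRel m} → R ≐ S → ∀ i → isSingletonᵇ R i ≡ isSingletonᵇ S i
    isSingletonᵇ-resp R≐S i = all-cong (allFin m) (λ j → cong (λ b → does (b ≟ᴮ _)) (R≐S i j))

  data Constraint : Set where
    free single nonSingle : Constraint

  satisfies : Constraint → Bool → Bool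
  satisfies free      _         = true
  satisfies single    singleton = singleton
  satisfies nonSingle singleton = not singleton

  module _ {m : ℕ} where

    conforms : (Fin m → Constraint) → BRel m → Bool
    conforms c R = isEquivᵇ R ∧ all (λ i → satisfies (c i) (isSingletonᵇ R i)) (allFin m)

    conforms-sound : ∀ c (R : BRel m) → conforms c R ≡ true →
      IsPartition R × (∀ i → satisfies (c i) (isSingletonᵇ R i) ≡ true)
    conforms-sound c R h = let (E , sat) = ∧-elim {isEquivᵇ R} h in isEquivᵇ-sound R E , all-allFin⁻ sat

    conforms-complete : ∀ c (R : BRel m) → IsPartition R →
      (∀ i → satisfies (c i) (isSingletonᵇ R i) ≡ true) → conforms c R ≡ true
    conforms-complete c R E sat = ∧-intro (isEquivᵇ-complete R E) (all-allFin⁺ sat)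

    conforms-resp : ∀ c {R S : BRel m} → R ≐ S → conforms c R ≡ true → conforms c S ≡ true
    conforms-resp c R≐S = subst (_≡ true)
      (cong₂ _∧_ (isEquivᵇ-resp R≐S) (all-cong (allFin m) (λ i → cong (satisfies (c i)) (isSingletonᵇ-resp R≐S i))))

  #partitions : (m : ℕ) → (Fin m → Constraint) → ℕ
  #partitions m c = count (conforms c) (allBRels m)

  #partitions-cong : ∀ m {c c' : Fin m → Constraint} → (∀ i → c i ≡ c' i) → #partitions m c ≡ #partitions m c'
  #partitions-cong m c≡c' = count-cong (allBRels m) (λ R →
    cong (isEquivᵇ R ∧_) (all-cong (allFin m) (λ i → cong (λ x → satisfies x (isSingletonᵇ R i)) (c≡c' i))))

  #partitions-split : ∀ m (c : Fin m → Constraint) (t : Fin m) → c t ≡ free →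
    #partitions m c ≡ #partitions m (updateAt c t λ _ → single) + #partitions m (updateAt c t λ _ → nonSingle)
  #partitions-split m c t ct≡free = trans (count-split (allBRels m) (conforms c) (λ R → isSingletonᵇ R t))
    (cong₂ _+_ (count-cong (allBRels m) (λ R → bool-ext (fix single R) (unfix single R)))
               (count-cong (allBRels m) (λ R → bool-ext (fix nonSingle R) (unfix nonSingle R))))
    where
    at : Constraint → Fin m → Constraint
    at x = updateAt c t (λ _ → x)

    fix : ∀ x R → conforms c R ∧ satisfies x (isSingletonᵇ R t) ≡ true → conforms (at x) R ≡ true
    fix x R h with ∧-elim {conforms c R} h
    ... | conf , sat-t with conforms-sound c R conf
    ... | E , sat = conforms-complete (at x) R E sat'
      where
      sat' : ∀ i → satisfies (at x i) (isSingletonᵇ R i) ≡ true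
      sat' i with i ≟ t
      ... | yes refl = subst (λ y → satisfies y _ ≡ true) (sym (updateAt-updates t c)) sat-t
      ... | no  i≢t  = subst (λ y → satisfies y _ ≡ true) (sym (updateAt-minimal i t c i≢t)) (sat i)

    unfix : ∀ x R → conforms (at x) R ≡ true → conforms c R ∧ satisfies x (isSingletonᵇ R t) ≡ true
    unfix x R h with conforms-sound (at x) R h
    ... | E , sat = ∧-intro (conforms-complete c R E sat')
      (subst (λ y → satisfies y _ ≡ true) (updateAt-updates t c) (sat t))
      where
      sat' : ∀ i → satisfies (c i) (isSingletonᵇ R i) ≡ true
      sat' i with i ≟ t
      ... | yes refl = subst (λ y → satisfies y _ ≡ true) (sym ct≡free) refl
      ... | no  i≢t  = subst (λ y → satisfies y _ ≡ true) (updateAt-minimal i t c i≢t) (sat i)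

  relabel : ∀ {m n} → (Fin n → Fin m) → BRel m → BRel n
  relabel σ R i j = R (σ i) (σ j)

  relabel-partition : ∀ {m n} (σ : Fin n → Fin m) (R : BRel m) → IsPartition R → IsPartition (relabel σ R)
  relabel-partition σ R E = record { refl = E.refl ; sym = E.sym ; trans = E.trans }
    where module E = IsEquivalence E

  module _ {m : ℕ} (π : Permutation m m) where

    private
      πʳ πˡ : Fin m → Fin m
      πʳ = π ⟨$⟩ʳ_
      πˡ = π ⟨$⟩ˡ_

    relabel-inverse : (R : BRel m) → relabel πˡ (relabel πʳ R) ≐ R
    relabel-inverse R i j = cong₂ R (inverseʳ π) (inverseʳ π)

    relabel-inverse′ : (R : BRel m) → relabel πʳ (relabel πˡ R) ≐ R
    relabel-inverse′ R i j = cong₂ R (inverseˡ π) (inverseˡ π)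

    isEquivᵇ-relabel : (R : BRel m) → isEquivᵇ (relabel πʳ R) ≡ isEquivᵇ R
    isEquivᵇ-relabel R = bool-ext
      (λ h → trans (sym (isEquivᵇ-resp (relabel-inverse R)))
                   (isEquivᵇ-complete _ (relabel-partition πˡ (relabel πʳ R) (isEquivᵇ-sound (relabel πʳ R) h))))
      (λ h → isEquivᵇ-complete (relabel πʳ R) (relabel-partition πʳ R (isEquivᵇ-sound R h)))

    ≟-relabel : ∀ i j → does (πʳ i ≟ πʳ j) ≡ does (i ≟ j)
    ≟-relabel i j = bool-ext
      (λ h → dec-true (i ≟ j) (trans (sym (inverseˡ π)) (trans (cong πˡ (does-sound (πʳ i ≟ πʳ j) h)) (inverseˡ π))))
      (λ h → dec-true (πʳ i ≟ πʳ j) (cong πʳ (does-sound (i ≟ j) h)))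

    isSingletonᵇ-relabel : (R : BRel m) (i : Fin m) → isSingletonᵇ (relabel πʳ R) i ≡ isSingletonᵇ R (πʳ i)
    isSingletonᵇ-relabel R i = bool-ext
      (λ h → isSingletonᵇ-complete R (πʳ i) λ j → begin
        R (πʳ i) j               ≡⟨ cong (R (πʳ i)) (inverseʳ π) ⟨
        R (πʳ i) (πʳ (πˡ j))     ≡⟨ isSingletonᵇ-sound (relabel πʳ R) i h (πˡ j) ⟩
        does (πˡ j ≟ i)          ≡⟨ ≟-relabel (πˡ j) i ⟨
        does (πʳ (πˡ j) ≟ πʳ i)  ≡⟨ cong (λ k → does (k ≟ πʳ i)) (inverseʳ π) ⟩
        does (j ≟ πʳ i)          ∎)
      (λ h → isSingletonᵇ-complete (relabel πʳ R) i λ j →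
        trans (isSingletonᵇ-sound R (πʳ i) h (πʳ j)) (≟-relabel j i))

    all-permute : (p : Fin m → Bool) → all (p ∘ πʳ) (allFin m) ≡ all p (allFin m)
    all-permute p = bool-ext
      (λ h → all-allFin⁺ (λ i → subst (λ k → p k ≡ true) (inverseʳ π) (all-allFin⁻ h (πˡ i))))
      (λ h → all-allFin⁺ (λ i → all-allFin⁻ h (πʳ i)))

    conforms-relabel : ∀ c (R : BRel m) → conforms (c ∘ πʳ) (relabel πʳ R) ≡ conforms c R
    conforms-relabel c R = cong₂ _∧_ (isEquivᵇ-relabel R)
      (trans (all-cong (allFin m) (λ i → cong (satisfies (c (πʳ i))) (isSingletonᵇ-relabel R i)))
             (all-permute (λ i → satisfies (c i) (isSingletonᵇ R i))))

    #partitions-permute : ∀ c → #partitions m c ≡ #partitions m (c ∘ πʳ)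
    #partitions-permute c = count-bijection (relation-enumeration m) (relation-enumeration m) record
      { to        = relabel πʳ
      ; from      = relabel πˡ
      ; p-resp    = conforms-resp c
      ; q-resp    = conforms-resp (c ∘ πʳ)
      ; to-cong   = λ R≐S i j → R≐S (πʳ i) (πʳ j)
      ; from-cong = λ R≐S i j → R≐S (πˡ i) (πˡ j)
      ; to-q      = λ R h → trans (conforms-relabel c R) h
      ; from-p    = λ S h → trans (sym (conforms-relabel c (relabel πˡ S)))
        (conforms-resp (c ∘ πʳ) (λ i j → sym (relabel-inverse′ S i j)) h)
      ; to-from   = λ S _ → relabel-inverse′ S
      ; from-to   = λ R _ → relabel-inverse R
      }

  module _ {m : ℕ} where

    addSingleton : BRel m → BRel (suc m)
    addSingleton S zero    zero    = true
    addSingleton S zero    (suc j) = false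
    addSingleton S (suc i) zero    = false
    addSingleton S (suc i) (suc j) = S i j

    addSingleton-partition : (S : BRel m) → IsPartition S → IsPartition (addSingleton S)
    addSingleton-partition S E = record
      { refl = λ {i} → r i ; sym = λ {i} {j} → s i j ; trans = λ {i} {j} {l} → t i j l }
      where
      module E = IsEquivalence E
      r : ∀ i → addSingleton S i i ≡ true
      r zero    = refl
      r (suc i) = E.refl
      s : ∀ i j → addSingleton S i j ≡ true → addSingleton S j i ≡ true
      s zero    zero    h = refl
      s (suc i) (suc j) h = E.sym h
      t : ∀ i j l → addSingleton S i j ≡ true → addSingleton S j l ≡ true → addSingleton S i l ≡ true
      t zero    zero    l       _ h = h
      t (suc i) (suc j) (suc l) h h' = E.trans h h'

    addSingleton-cong : {S S' : BRel m} → S ≐ S' → addSingleton S ≐ addSingleton S'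
    addSingleton-cong S≐S' zero    zero    = refl
    addSingleton-cong S≐S' zero    (suc j) = refl
    addSingleton-cong S≐S' (suc i) zero    = refl
    addSingleton-cong S≐S' (suc i) (suc j) = S≐S' i j

    addSingleton-isSingleton : (S : BRel m) → IsSingleton (addSingleton S) zero
    addSingleton-isSingleton S zero    = refl
    addSingleton-isSingleton S (suc j) = refl

    isSingletonᵇ-addSingleton : (S : BRel m) (i : Fin m) → isSingletonᵇ (addSingleton S) (suc i) ≡ isSingletonᵇ S i
    isSingletonᵇ-addSingleton S i = bool-ext
      (λ h → isSingletonᵇ-complete S i (λ j → isSingletonᵇ-sound (addSingleton S) (suc i) h (suc j)))
      (λ h → isSingletonᵇ-complete (addSingleton S) (suc i) λ
        { zero → refl ; (suc j) → isSingletonᵇ-sound S i h j })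

    module _ (R : BRel (suc m)) (E : IsPartition R) (R₀ : IsSingleton R zero) where
      private module E = IsEquivalence E

      singleton-column : ∀ i → R (suc i) zero ≡ false
      singleton-column i with R (suc i) zero in Ri0
      ... | true  = sym (trans (sym (R₀ (suc i))) (E.sym Ri0))
      ... | false = refl

      addSingleton-restrict : addSingleton (relabel suc R) ≐ R
      addSingleton-restrict zero    zero    = sym E.refl
      addSingleton-restrict zero    (suc j) = sym (R₀ (suc j))
      addSingleton-restrict (suc i) zero    = sym (singleton-column i)
      addSingleton-restrict (suc i) (suc j) = refl

      isSingletonᵇ-restrict : ∀ i → isSingletonᵇ R (suc i) ≡ isSingletonᵇ (relabel suc R) i
      isSingletonᵇ-restrict i =
        trans (isSingletonᵇ-resp (λ j l → sym (addSingleton-restrict j l)) (suc i)) (isSingletonᵇ-addSingleton _ i)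

    #partitions-remove-singleton : (c : Fin m → Constraint) → #partitions (suc m) (single ◂ c) ≡ #partitions m c
    #partitions-remove-singleton c = count-bijection (relation-enumeration (suc m)) (relation-enumeration m) record
      { to        = relabel suc
      ; from      = addSingleton
      ; p-resp    = conforms-resp (single ◂ c)
      ; q-resp    = conforms-resp c
      ; to-cong   = λ R≐S i j → R≐S (suc i) (suc j)
      ; from-cong = addSingleton-cong
      ; to-q      = to-q
      ; from-p    = from-p
      ; from-to   = λ R h → let (E , sat) = conforms-sound (single ◂ c) R h in
                              addSingleton-restrict R E (isSingletonᵇ-sound R zero (sat zero))
      ; to-from   = λ S _ i j → refl
      }
      where
      to-q : ∀ R → conforms (single ◂ c) R ≡ true → conforms c (relabel suc R) ≡ true
      to-q R h with conforms-sound (single ◂ c) R h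
      ... | E , sat = conforms-complete c (relabel suc R) (relabel-partition suc R E) λ i →
        trans (cong (satisfies (c i))
            (sym (isSingletonᵇ-restrict R E (isSingletonᵇ-sound R zero (sat zero)) i))) (sat (suc i))

      from-p : ∀ S → conforms c S ≡ true → conforms (single ◂ c) (addSingleton S) ≡ true
      from-p S h with conforms-sound c S h
      ... | E , sat = conforms-complete (single ◂ c) (addSingleton S) (addSingleton-partition S E) λ
        { zero    → isSingletonᵇ-complete (addSingleton S) zero (addSingleton-isSingleton S)
        ; (suc i) → trans (cong (satisfies (c i)) (isSingletonᵇ-addSingleton S i)) (sat i) }

  -- Blocks and Stirling numbers

  private
    not-true : ∀ {b} → not b ≡ true → b ≡ false
    not-true {false} _ = refl

    false≢true : ∀ {A : Set} → false ≡ true → A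
    false≢true ()

  module _ {k : ℕ} where

    IsLeast : BRel k → Fin k → Set
    IsLeast S i = ∀ j → toℕ j < toℕ i → S i j ≡ false

    isLeastᵇ : BRel k → Fin k → Bool
    isLeastᵇ S i = all (λ j → does (toℕ j <? toℕ i) ⇒ᵇ not (S i j)) (allFin k)

    isLeastᵇ-sound : (S : BRel k) (i : Fin k) → isLeastᵇ S i ≡ true → IsLeast S i
    isLeastᵇ-sound S i h j j<i = not-true (⇒ᵇ-elim (all-allFin⁻ h j) (dec-true (toℕ j <? toℕ i) j<i))

    isLeastᵇ-complete : (S : BRel k) (i : Fin k) → IsLeast S i → isLeastᵇ S i ≡ true
    isLeastᵇ-complete S i h = all-allFin⁺ (λ j → ⇒ᵇ-intro (λ j<i → cong not (h j (does-sound (toℕ j <? toℕ i) j<i))))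

    isLeastᵇ-resp : {S S' : BRel k} → S ≐ S' → ∀ i → isLeastᵇ S i ≡ isLeastᵇ S' i
    isLeastᵇ-resp S≐S' i = all-cong (allFin k) (λ j → cong (λ b → does (toℕ j <? toℕ i) ⇒ᵇ not b) (S≐S' i j))

    #blocks : BRel k → ℕ
    #blocks S = count (isLeastᵇ S) (allFin k)

    #blocks-resp : {S S' : BRel k} → S ≐ S' → #blocks S ≡ #blocks S'
    #blocks-resp S≐S' = count-cong (allFin k) (isLeastᵇ-resp S≐S')

    #blocks≤ : (S : BRel k) → #blocks S ≤ k
    #blocks≤ S = count-allFin≤ (isLeastᵇ S)

  module _ {k : ℕ} where

    isLeastᵇ-zero : (R : BRel (suc k)) → isLeastᵇ R zero ≡ true
    isLeastᵇ-zero R = isLeastᵇ-complete R zero (λ j ())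

    isLeastᵇ-suc : (R : BRel (suc k)) (i : Fin k) →
      isLeastᵇ R (suc i) ≡ isLeastᵇ (relabel suc R) i ∧ not (R (suc i) zero)
    isLeastᵇ-suc R i = bool-ext
      (λ h → ∧-intro (isLeastᵇ-complete (relabel suc R) i (λ j j<i → isLeastᵇ-sound R (suc i) h (suc j) (s≤s j<i)))
                     (cong not (isLeastᵇ-sound R (suc i) h zero (s≤s z≤n))))
      (λ h → let (least , apart) = ∧-elim {isLeastᵇ (relabel suc R) i} h in isLeastᵇ-complete R (suc i) λ
        { zero    _         → not-true apart
        ; (suc j) (s≤s j<i) → isLeastᵇ-sound (relabel suc R) i least j j<i })

    #blocks-suc : (R : BRel (suc k)) →
      #blocks R ≡ suc (count (λ i → isLeastᵇ (relabel suc R) i ∧ not (R (suc i) zero)) (allFin k))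
    #blocks-suc R = trans (count-allFin-suc (isLeastᵇ R))
      (cong₂ _+_ (cong indicator (isLeastᵇ-zero R)) (count-cong (allFin k) (isLeastᵇ-suc R)))

    module _ (S : BRel k) (E : IsPartition S) (a : Fin k) (a-least : IsLeast S a) where
      private module E = IsEquivalence E

      least-in-block-unique : ∀ i → IsLeast S i → S i a ≡ true → i ≡ a
      least-in-block-unique i i-least Sia with <-cmp (toℕ i) (toℕ a)
      ... | tri< i<a _ _ = false≢true (trans (sym (a-least i i<a)) (E.sym Sia))
      ... | tri≈ _ i≡a _ = toℕ-injective i≡a
      ... | tri> _ _ a<i = false≢true (trans (sym (i-least a a<i)) Sia)

      count-least-in-block : count (λ i → isLeastᵇ S i ∧ S i a) (allFin k) ≡ 1
      count-least-in-block = trans (count-cong (allFin k) is-a) (count-≟ a)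
        where
        is-a : ∀ i → isLeastᵇ S i ∧ S i a ≡ does (a ≟ i)
        is-a i = bool-ext
          (λ h → let (least , Sia) = ∧-elim {isLeastᵇ S i} h in
            dec-true (a ≟ i) (sym (least-in-block-unique i (isLeastᵇ-sound S i least) Sia)))
          (λ h → subst (λ j → isLeastᵇ S j ∧ S j a ≡ true) (does-sound (a ≟ i) h)
            (∧-intro (isLeastᵇ-complete S a a-least) E.refl))

      #blocks-outside-block : (q : Fin k → Bool) → (∀ i → q i ≡ S i a) →
        suc (count (λ i → isLeastᵇ S i ∧ not (q i)) (allFin k)) ≡ #blocks S
      #blocks-outside-block q q≡Sa = sym (trans (count-split (allFin k) (isLeastᵇ S) q)
        (cong (_+ count (λ i → isLeastᵇ S i ∧ not (q i)) (allFin k))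
          (trans (count-cong (allFin k) (λ i → cong (isLeastᵇ S i ∧_) (q≡Sa i))) count-least-in-block)))

  first : ∀ {k} → (Fin k → Bool) → Maybe (Fin k)
  first {zero}  p = nothing
  first {suc k} p with p zero
  ... | true  = just zero
  ... | false with first (p ∘ suc)
  ...   | nothing = nothing
  ...   | just i  = just (suc i)

  first-nothing⁻ : ∀ {k} (p : Fin k → Bool) → first p ≡ nothing → ∀ i → p i ≡ false
  first-nothing⁻ {suc k} p h i with p zero in p₀
  first-nothing⁻ {suc k} p () i | true
  ... | false with first (p ∘ suc) in rest
  first-nothing⁻ {suc k} p h zero    | false | nothing = p₀
  first-nothing⁻ {suc k} p h (suc i) | false | nothing = first-nothing⁻ (p ∘ suc) rest i

  first-just⁻ : ∀ {k} (p : Fin k → Bool) {i} → first p ≡ just i → p i ≡ true × (∀ j → toℕ j < toℕ i → p j ≡ false)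
  first-just⁻ {suc k} p h with p zero in p₀
  first-just⁻ {suc k} p refl | true = p₀ , λ _ ()
  ... | false with first (p ∘ suc) in rest
  first-just⁻ {suc k} p refl | false | just i =
    proj₁ (first-just⁻ (p ∘ suc) rest) ,
      λ { zero _ → p₀ ; (suc j) (s≤s j<i) → proj₂ (first-just⁻ (p ∘ suc) rest) j j<i }

  first-nothing⁺ : ∀ {k} (p : Fin k → Bool) → (∀ i → p i ≡ false) → first p ≡ nothing
  first-nothing⁺ {zero}  p h = refl
  first-nothing⁺ {suc k} p h rewrite h zero | first-nothing⁺ (p ∘ suc) (h ∘ suc) = refl

  first-just⁺ : ∀ {k} (p : Fin k → Bool) i → p i ≡ true → (∀ j → toℕ j < toℕ i → p j ≡ false) → first p ≡ just i
  first-just⁺ {suc k} p zero    pi _ rewrite pi = refl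
  first-just⁺ {suc k} p (suc i) pi h
    rewrite h zero (s≤s z≤n) | first-just⁺ (p ∘ suc) i pi (λ j j<i → h (suc j) (s≤s j<i)) = refl

  first-cong : ∀ {k} (p q : Fin k → Bool) → (∀ i → p i ≡ q i) → first p ≡ first q
  first-cong {zero}  p q p≡q = refl
  first-cong {suc k} p q p≡q with p zero | q zero | p≡q zero
  ... | true  | true  | refl = refl
  ... | false | false | refl rewrite first-cong (p ∘ suc) (q ∘ suc) (p≡q ∘ suc) = refl

  module _ {k : ℕ} where

    addToBlock : Fin k → BRel k → BRel (suc k)
    addToBlock a S zero    zero    = true
    addToBlock a S zero    (suc j) = S a j
    addToBlock a S (suc i) zero    = S i a
    addToBlock a S (suc i) (suc j) = S i j

    addToBlock-cong : (a : Fin k) {S S' : BRel k} → S ≐ S' → addToBlock a S ≐ addToBlock a S'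
    addToBlock-cong a S≐S' zero    zero    = refl
    addToBlock-cong a S≐S' zero    (suc j) = S≐S' a j
    addToBlock-cong a S≐S' (suc i) zero    = S≐S' i a
    addToBlock-cong a S≐S' (suc i) (suc j) = S≐S' i j

    addToBlock-partition : (a : Fin k) (S : BRel k) → IsPartition S → IsPartition (addToBlock a S)
    addToBlock-partition a S E = record
      { refl = λ {i} → r i ; sym = λ {i} {j} → s i j ; trans = λ {i} {j} {l} → t i j l }
      where
      module E = IsEquivalence E
      r : ∀ i → addToBlock a S i i ≡ true
      r zero    = refl
      r (suc i) = E.refl
      s : ∀ i j → addToBlock a S i j ≡ true → addToBlock a S j i ≡ true
      s zero    zero    h = refl
      s zero    (suc j) h = E.sym h
      s (suc i) zero    h = E.sym h
      s (suc i) (suc j) h = E.sym h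
      t : ∀ i j l → addToBlock a S i j ≡ true → addToBlock a S j l ≡ true → addToBlock a S i l ≡ true
      t zero    zero    l       _ h  = h
      t zero    (suc j) zero    _ _  = refl
      t zero    (suc j) (suc l) h h' = E.trans h h'
      t (suc i) zero    zero    h _  = h
      t (suc i) zero    (suc l) h h' = E.trans h h'
      t (suc i) (suc j) zero    h h' = E.trans h h'
      t (suc i) (suc j) (suc l) h h' = E.trans h h'

    #blocks-addSingleton : (S : BRel k) → #blocks (addSingleton S) ≡ suc (#blocks S)
    #blocks-addSingleton S = trans (#blocks-suc (addSingleton S))
      (cong suc (count-cong (allFin k) (λ i → ∧-identityʳ (isLeastᵇ S i))))

    #blocks-addToBlock : (a : Fin k) (S : BRel k) → IsPartition S → IsLeast S a → #blocks (addToBlock a S) ≡ #blocks S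
    #blocks-addToBlock a S E a-least =
      trans (#blocks-suc (addToBlock a S)) (#blocks-outside-block S E a a-least (λ i → S i a) (λ _ → refl))

    firstNeighbour : BRel (suc k) → Maybe (Fin k)
    firstNeighbour R = first (λ i → R zero (suc i))

    module _ (R : BRel (suc k)) (E : IsPartition R) where
      private module E = IsEquivalence E

      neighbourless-isSingleton : firstNeighbour R ≡ nothing → IsSingleton R zero
      neighbourless-isSingleton h zero    = E.refl
      neighbourless-isSingleton h (suc j) = first-nothing⁻ _ h j

      module _ {a : Fin k} (h : firstNeighbour R ≡ just a) where
        private
          R0a : R zero (suc a) ≡ true
          R0a = proj₁ (first-just⁻ _ h)

        firstNeighbour-least : IsLeast (relabel suc R) a
        firstNeighbour-least j j<a with R (suc a) (suc j) in Raj
        ... | true  = sym (trans (sym (proj₂ (first-just⁻ _ h) j j<a)) (E.trans R0a Raj))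
        ... | false = refl

        addToBlock-restrict : addToBlock a (relabel suc R) ≐ R
        addToBlock-restrict zero    zero    = sym E.refl
        addToBlock-restrict zero    (suc j) = bool-ext (E.trans R0a) (E.trans (E.sym R0a))
        addToBlock-restrict (suc i) zero    = bool-ext (λ Ria → E.trans Ria (E.sym R0a)) (λ Ri0 → E.trans Ri0 R0a)
        addToBlock-restrict (suc i) (suc j) = refl

  hasBlocks : ∀ {k} → ℕ → BRel k → Bool
  hasBlocks j S = isEquivᵇ S ∧ does (#blocks S ℕ.≟ j)

  hasBlocks-sound : ∀ {k j} (S : BRel k) → hasBlocks j S ≡ true → IsPartition S × #blocks S ≡ j
  hasBlocks-sound S h = let (E , #S) = ∧-elim {isEquivᵇ S} h in isEquivᵇ-sound S E , does-sound (_ ℕ.≟ _) #S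

  hasBlocks-complete : ∀ {k j} (S : BRel k) → IsPartition S → #blocks S ≡ j → hasBlocks j S ≡ true
  hasBlocks-complete S E #S = ∧-intro (isEquivᵇ-complete S E) (dec-true (_ ℕ.≟ _) #S)

  hasBlocks-resp : ∀ {k} j {S S' : BRel k} → S ≐ S' → hasBlocks j S ≡ hasBlocks j S'
  hasBlocks-resp j S≐S' = cong₂ _∧_ (isEquivᵇ-resp S≐S') (cong (λ n → does (n ℕ.≟ j)) (#blocks-resp S≐S'))

  #partitionsWithBlocks : ℕ → ℕ → ℕ
  #partitionsWithBlocks k j = count (hasBlocks j) (allBRels k)

  module _ (k j : ℕ) where

    -- A partition of Fin (suc k) either has 0 as a singleton, or is obtained by adding 0 to the block
    -- of a partition of the remaining elements whose least element is the first neighbour of 0.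
    private
      _≈ₚ_ = Enumeration._≈_ (product-enumeration (relation-enumeration k) (maybe-fin-enumeration k))

    attachable : BRel k × Maybe (Fin k) → Bool
    attachable (S , nothing) = hasBlocks j S
    attachable (S , just a)  = isLeastᵇ S a ∧ hasBlocks (suc j) S

    detachZero : BRel (suc k) → BRel k × Maybe (Fin k)
    detachZero R = relabel suc R , firstNeighbour R

    attachZero : BRel k × Maybe (Fin k) → BRel (suc k)
    attachZero (S , nothing) = addSingleton S
    attachZero (S , just a)  = addToBlock a S

    #partitionsWithBlocks≡#attachable :
      #partitionsWithBlocks (suc k) (suc j) ≡
      count attachable (Enumeration.elements (product-enumeration (relation-enumeration k) (maybe-fin-enumeration k)))
    #partitionsWithBlocks≡#attachable = count-bijection (relation-enumeration (suc k))
      (product-enumeration (relation-enumeration k) (maybe-fin-enumeration k)) record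
      { to        = detachZero
      ; from      = attachZero
      ; p-resp    = λ R≐R' → subst (_≡ true) (hasBlocks-resp (suc j) R≐R')
      ; q-resp    = q-resp
      ; to-cong   = λ R≐R' → (λ i j → R≐R' (suc i) (suc j)) , first-cong _ _ (λ i → R≐R' zero (suc i))
      ; from-cong = from-cong
      ; to-q      = to-q
      ; from-p    = from-p
      ; from-to   = from-to
      ; to-from   = to-from
      }
      where
      q-resp : ∀ {b b'} → b ≈ₚ b' → attachable b ≡ true → attachable b' ≡ true
      q-resp {S , nothing} (S≐S' , refl) = subst (_≡ true) (hasBlocks-resp j S≐S')
      q-resp {S , just a}  (S≐S' , refl) = subst (_≡ true)
        (cong₂ _∧_ (isLeastᵇ-resp S≐S' a) (hasBlocks-resp (suc j) S≐S'))

      from-cong : ∀ {b b'} → b ≈ₚ b' → attachZero b ≐ attachZero b'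
      from-cong {S , nothing} (S≐S' , refl) = addSingleton-cong S≐S'
      from-cong {S , just a}  (S≐S' , refl) = addToBlock-cong a S≐S'

      to-q : ∀ R → hasBlocks (suc j) R ≡ true → attachable (detachZero R) ≡ true
      to-q R h with hasBlocks-sound R h
      ... | E , #R with firstNeighbour R in fn
      ... | nothing = hasBlocks-complete (relabel suc R) (relabel-partition suc R E) (suc-injective (begin
        suc (#blocks (relabel suc R))
          ≡⟨ #blocks-addSingleton (relabel suc R) ⟨
        #blocks (addSingleton (relabel suc R))
          ≡⟨ #blocks-resp (addSingleton-restrict R E (neighbourless-isSingleton R E fn)) ⟩
        #blocks R
          ≡⟨ #R ⟩
        suc j ∎))
      ... | just a  = ∧-intro (isLeastᵇ-complete (relabel suc R) a (firstNeighbour-least R E fn))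
        (hasBlocks-complete (relabel suc R) (relabel-partition suc R E) (begin
          #blocks (relabel suc R)
            ≡⟨ #blocks-addToBlock a _ (relabel-partition suc R E) (firstNeighbour-least R E fn) ⟨
          #blocks (addToBlock a (relabel suc R))
            ≡⟨ #blocks-resp (addToBlock-restrict R E fn) ⟩
          #blocks R
            ≡⟨ #R ⟩
          suc j ∎))

      from-p : ∀ b → attachable b ≡ true → hasBlocks (suc j) (attachZero b) ≡ true
      from-p (S , nothing) h with hasBlocks-sound S h
      ... | E , #S = hasBlocks-complete (addSingleton S) (addSingleton-partition S E)
        (trans (#blocks-addSingleton S) (cong suc #S))
      from-p (S , just a) h with ∧-elim {isLeastᵇ S a} h
      ... | least , blocks with hasBlocks-sound S blocks
      ... | E , #S = hasBlocks-complete (addToBlock a S) (addToBlock-partition a S E)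
        (trans (#blocks-addToBlock a S E (isLeastᵇ-sound S a least)) #S)

      from-to : ∀ R → hasBlocks (suc j) R ≡ true → attachZero (detachZero R) ≐ R
      from-to R h with hasBlocks-sound R h
      ... | E , _ with firstNeighbour R in fn
      ... | nothing = addSingleton-restrict R E (neighbourless-isSingleton R E fn)
      ... | just a  = addToBlock-restrict R E fn

      to-from : ∀ b → attachable b ≡ true → detachZero (attachZero b) ≈ₚ b
      to-from (S , nothing) _ = (λ _ _ → refl) , first-nothing⁺ _ (λ _ → refl)
      to-from (S , just a)  h with ∧-elim {isLeastᵇ S a} h
      ... | least , blocks = (λ _ _ → refl) ,
        first-just⁺ (S a) a (IsEquivalence.refl (proj₁ (hasBlocks-sound S blocks))) (isLeastᵇ-sound S a least)

  #partitionsWithBlocks-suc : ∀ k j →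
    #partitionsWithBlocks (suc k) (suc j) ≡ #partitionsWithBlocks k j + suc j * #partitionsWithBlocks k (suc j)
  #partitionsWithBlocks-suc k j = begin
    #partitionsWithBlocks (suc k) (suc j)
      ≡⟨ #partitionsWithBlocks≡#attachable k j ⟩
    sumOver (concatMap _ (allBRels k)) (indicator ∘ attachable k j)
      ≡⟨ sumOver-concatMap (allBRels k) _ _ ⟩
    sumOver (allBRels k) (λ S → sumOver (map (S ,_) (nothing ∷ map just (allFin k))) (indicator ∘ attachable k j))
      ≡⟨ sumOver-cong (allBRels k) (λ S → sumOver-map (nothing ∷ map just (allFin k)) (S ,_) _) ⟩
    sumOver (allBRels k) (λ S → indicator (hasBlocks j S) + sumOver (map just (allFin k))
        (λ o → indicator (attachable k j (S , o))))
      ≡⟨ sumOver-cong (allBRels k) (λ S → cong (indicator (hasBlocks j S) +_) (joined S)) ⟩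
    sumOver (allBRels k) (λ S → indicator (hasBlocks j S) + suc j * indicator (hasBlocks (suc j) S))
      ≡⟨ sumOver-distrib-+ (allBRels k) _ _ ⟩
    #partitionsWithBlocks k j + sumOver (allBRels k) (λ S → suc j * indicator (hasBlocks (suc j) S))
      ≡⟨ cong (#partitionsWithBlocks k j +_) (sumOver-distribˡ-* (allBRels k) (suc j) _) ⟩
    #partitionsWithBlocks k j + suc j * #partitionsWithBlocks k (suc j) ∎
    where
    joined : ∀ S → sumOver (map just (allFin k)) (λ o → indicator (attachable k j (S , o)))
                   ≡ suc j * indicator (hasBlocks (suc j) S)
    joined S = begin
      sumOver (map just (allFin k)) (λ o → indicator (attachable k j (S , o)))
        ≡⟨ sumOver-map (allFin k) just _ ⟩
      sumOver (allFin k) (λ a → indicator (isLeastᵇ S a ∧ hasBlocks (suc j) S))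
        ≡⟨ sumOver-cong (allFin k) (λ a → indicator-∧ (isLeastᵇ S a) _) ⟩
      sumOver (allFin k) (λ a → indicator (isLeastᵇ S a) * indicator (hasBlocks (suc j) S))
        ≡⟨ sumOver-distribʳ-* (allFin k) _ (indicator ∘ isLeastᵇ S) ⟩
      #blocks S * indicator (hasBlocks (suc j) S)
        ≡⟨ blocks-count ⟩
      suc j * indicator (hasBlocks (suc j) S) ∎
      where
      blocks-count : #blocks S * indicator (hasBlocks (suc j) S) ≡ suc j * indicator (hasBlocks (suc j) S)
      blocks-count with hasBlocks (suc j) S in h
      ... | false = trans (*-zeroʳ (#blocks S)) (sym (*-zeroʳ (suc j)))
      ... | true  = cong (_* 1) (proj₂ (hasBlocks-sound S h))

  #partitionsWithBlocks-zero : ∀ k → #partitionsWithBlocks (suc k) 0 ≡ 0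
  #partitionsWithBlocks-zero k = count-none (allBRels (suc k)) (λ R →
    trans (cong (λ n → isEquivᵇ R ∧ does (n ℕ.≟ 0)) (#blocks-suc R)) (∧-zeroʳ (isEquivᵇ R)))

  stirling : ℕ → ℕ → ℕ
  stirling zero    zero    = 1
  stirling zero    (suc j) = 0
  stirling (suc k) zero    = 0
  stirling (suc k) (suc j) = stirling k j + suc j * stirling k (suc j)

  stirling-vanishes : ∀ {k j} → k < j → stirling k j ≡ 0
  stirling-vanishes {zero}  {suc j} _         = refl
  stirling-vanishes {suc k} {suc j} (s≤s k<j)
    rewrite stirling-vanishes k<j | stirling-vanishes (m<n⇒m<1+n k<j) = *-zeroʳ (suc j)

  #partitionsWithBlocks≡stirling : ∀ k j → #partitionsWithBlocks k j ≡ stirling k j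
  #partitionsWithBlocks≡stirling zero    zero    = refl
  #partitionsWithBlocks≡stirling zero    (suc j) = refl
  #partitionsWithBlocks≡stirling (suc k) zero    = #partitionsWithBlocks-zero k
  #partitionsWithBlocks≡stirling (suc k) (suc j) = trans (#partitionsWithBlocks-suc k j)
    (cong₂ _+_ (#partitionsWithBlocks≡stirling k j) (cong (suc j *_) (#partitionsWithBlocks≡stirling k (suc j))))

  sumOver-∑ : {A : Set} (xs : List A) (B : ℕ) (f : A → ℕ → ℕ) →
    sumOver xs (λ x → ∑[ j < B ] f x j) ≡ ∑[ j < B ] sumOver xs (λ x → f x j)
  sumOver-∑ xs zero    f = sumOver-zero xs (λ _ → refl)
  sumOver-∑ xs (suc B) f = trans (sumOver-distrib-+ xs (λ x → f x 0) _)
    (cong (sumOver xs (λ x → f x 0) +_) (sumOver-∑ xs B (λ x j → f x (suc j))))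

  ∑-indicator-≟ : ∀ {v B} → v < B → ∑[ j < B ] indicator (does (v ℕ.≟ j)) ≡ 1
  ∑-indicator-≟ {zero}  {suc B} _         = cong suc (∑-zero B (λ _ _ → refl))
  ∑-indicator-≟ {suc v} {suc B} (s≤s v<B) = ∑-indicator-≟ v<B

  indicator-by-value : ∀ b {v B} → v < B → indicator b ≡ ∑[ j < B ] indicator (b ∧ does (v ℕ.≟ j))
  indicator-by-value b {v} {B} v<B = begin
    indicator b                                               ≡⟨ *-identityʳ (indicator b) ⟨
    indicator b * 1                                           ≡⟨ cong (indicator b *_) (∑-indicator-≟ v<B) ⟨
    indicator b * ∑[ j < B ] indicator (does (v ℕ.≟ j))         ≡⟨ ∑-distribˡ-* B (indicator b) _ ⟩
    ∑[ j < B ] (indicator b * indicator (does (v ℕ.≟ j)))       ≡⟨ ∑-cong B (λ j _ → indicator-∧ b _) ⟨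
    ∑[ j < B ] indicator (b ∧ does (v ℕ.≟ j))                   ∎

  #partitions-free : ∀ k → #partitions k (λ _ → free) ≡ ∑[ j < suc k ] stirling k j
  #partitions-free k = begin
    #partitions k (λ _ → free)
      ≡⟨ count-cong (allBRels k)
        (λ R → trans (cong (isEquivᵇ R ∧_)
              (all-allFin⁺ {p = λ i → satisfies free (isSingletonᵇ R i)} (λ _ → refl))) (∧-identityʳ (isEquivᵇ R))) ⟩
    sumOver (allBRels k) (λ R → indicator (isEquivᵇ R))
      ≡⟨ sumOver-cong (allBRels k) (λ R → indicator-by-value (isEquivᵇ R) (s≤s (#blocks≤ R))) ⟩
    sumOver (allBRels k) (λ R → ∑[ j < suc k ] indicator (hasBlocks j R))
      ≡⟨ sumOver-∑ (allBRels k) (suc k) (λ R j → indicator (hasBlocks j R)) ⟩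
    ∑[ j < suc k ] #partitionsWithBlocks k j
      ≡⟨ ∑-cong (suc k) (λ j _ → #partitionsWithBlocks≡stirling k j) ⟩
    ∑[ j < suc k ] stirling k j ∎

  -- The largest singleton

  largestSingletonAt : ℕ → ∀ {m} → Fin m → Constraint
  largestSingletonAt k i = if does (toℕ i ℕ.<? k) then free else if does (toℕ i ℕ.≟ k) then single else nonSingle

  freeBelow : ℕ → ∀ {m} → Fin m → Constraint
  freeBelow k i = if does (toℕ i ℕ.<? k) then free else nonSingle

  module _ {m : ℕ} (k : ℕ) (i : Fin m) where

    largestSingletonAt-< : toℕ i < k → largestSingletonAt k i ≡ free
    largestSingletonAt-< i<k rewrite dec-true (toℕ i ℕ.<? k) i<k = refl

    largestSingletonAt-≡ : toℕ i ≡ k → largestSingletonAt k i ≡ single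
    largestSingletonAt-≡ i≡k
      rewrite dec-false (toℕ i ℕ.<? k) (λ i<k → <-irrefl i≡k i<k) | dec-true (toℕ i ℕ.≟ k) i≡k = refl

    largestSingletonAt-> : k < toℕ i → largestSingletonAt k i ≡ nonSingle
    largestSingletonAt-> k<i
      rewrite dec-false (toℕ i ℕ.<? k) (≤⇒≯ (<⇒≤ k<i)) | dec-false (toℕ i ℕ.≟ k)
        (λ i≡k → <-irrefl (sym i≡k) k<i) = refl

    freeBelow-< : toℕ i < k → freeBelow k i ≡ free
    freeBelow-< i<k rewrite dec-true (toℕ i ℕ.<? k) i<k = refl

    freeBelow-≥ : k ≤ toℕ i → freeBelow k i ≡ nonSingle
    freeBelow-≥ k≤i rewrite dec-false (toℕ i ℕ.<? k) (≤⇒≯ k≤i) = refl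

  A≡#largestSingletonAt : ∀ N k → k < suc N → A N k ≡ #partitions (suc N) (largestSingletonAt k)
  A≡#largestSingletonAt N k k<1+N = trans (length-filter≡count _ (allBRels (suc N)))
    (count-cong (allBRels (suc N)) (λ R → cong (isEquivᵇ R ∧_) (bool-ext (sound R) (complete R))))
    where
    t : Fin (suc N)
    t = fromℕ< k<1+N

    fits : BRel (suc N) → Bool
    fits R = all (λ i → satisfies (largestSingletonAt k i) (isSingletonᵇ R i)) (allFin (suc N))

    singletonAt noSingletonAbove : BRel (suc N) → Fin (suc N) → Bool
    singletonAt       R i = (toℕ i ℕ.≡ᵇ k) ∧ isSingletonᵇ R i
    noSingletonAbove R i = (k ℕ.<ᵇ toℕ i) ⇒ᵇ not (isSingletonᵇ R i)

    sound : ∀ R → largestSingletonIsᵇ R k ≡ true → fits R ≡ true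
    sound R h = all-allFin⁺ sat
      where
      at = ∧-elim {any (singletonAt R) (allFin (suc N))} h
      sat : ∀ i → satisfies (largestSingletonAt k i) (isSingletonᵇ R i) ≡ true
      sat i with <-cmp (toℕ i) k
      ... | tri< i<k _ _ rewrite largestSingletonAt-< k i i<k = refl
      ... | tri≈ _ i≡k _ rewrite largestSingletonAt-≡ k i i≡k =
        let (j , j-at) = any-allFin⁻ {p = singletonAt R} (proj₁ at)
            (j≡k , j-single) = ∧-elim {toℕ j ℕ.≡ᵇ k} j-at
        in subst (λ l → isSingletonᵇ R l ≡ true)
          (toℕ-injective (trans (does-sound (toℕ j ℕ.≟ k) j≡k) (sym i≡k))) j-single
      ... | tri> _ _ k<i rewrite largestSingletonAt-> k i k<i = ⇒ᵇ-elim
        (all-allFin⁻ {p = noSingletonAbove R} (proj₂ at) i) (dec-true (k ℕ.<? toℕ i) k<i)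

    complete : ∀ R → fits R ≡ true → largestSingletonIsᵇ R k ≡ true
    complete R h = ∧-intro {any (singletonAt R) (allFin (suc N))}
      (any-allFin⁺ {p = singletonAt R} t (∧-intro {toℕ t ℕ.≡ᵇ k} (dec-true (toℕ t ℕ.≟ k) (toℕ-fromℕ< k<1+N))
        (subst (λ c → satisfies c (isSingletonᵇ R t) ≡ true) (largestSingletonAt-≡ k t (toℕ-fromℕ< k<1+N))
            (all-allFin⁻ h t))))
      (all-allFin⁺ {p = noSingletonAbove R} (λ i → ⇒ᵇ-intro (λ k<i →
        subst (λ c → satisfies c (isSingletonᵇ R i) ≡ true)
          (largestSingletonAt-> k i (does-sound (k ℕ.<? toℕ i) k<i)) (all-allFin⁻ h i))))

  -- Swap k with 0, then delete the singleton 0.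
  #largestSingletonAt≡#freeBelow : ∀ m k → k < suc m →
    #partitions (suc m) (largestSingletonAt k) ≡ #partitions m (freeBelow k)
  #largestSingletonAt≡#freeBelow m k k<1+m = begin
    #partitions (suc m) (largestSingletonAt k)
      ≡⟨ #partitions-permute (Perm.transpose zero t) (largestSingletonAt k) ⟩
    #partitions (suc m) (largestSingletonAt k ∘ transpose zero t)
      ≡⟨ #partitions-cong (suc m) {largestSingletonAt k ∘ transpose zero t} moved ⟩
    #partitions (suc m) (single ◂ freeBelow k)
      ≡⟨ #partitions-remove-singleton {m} (freeBelow k) ⟩
    #partitions m (freeBelow k) ∎
    where
    t : Fin (suc m)
    t = fromℕ< k<1+m
    t≡k : toℕ t ≡ k
    t≡k = toℕ-fromℕ< k<1+m

    moved : ∀ i → largestSingletonAt k (transpose zero t i) ≡ (single ◂ freeBelow k) i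
    moved zero = largestSingletonAt-≡ k t t≡k
    moved (suc i) with suc i ≟ t
    ... | yes i+1≡t =
      let i+1≡k = trans (cong toℕ i+1≡t) t≡k in
      trans (largestSingletonAt-< {suc m} k zero (subst (0 <_) i+1≡k (s≤s z≤n)))
        (sym (freeBelow-< k i (subst (toℕ i <_) i+1≡k (n<1+n (toℕ i)))))
    ... | no  i+1≢t with <-cmp (suc (toℕ i)) k
    ...   | tri< i+1<k _ _ = trans (largestSingletonAt-< k (suc i) i+1<k)
      (sym (freeBelow-< k i (ℕₚ.<-trans (n<1+n _) i+1<k)))
    ...   | tri≈ _ i+1≡k _ = contradiction (toℕ-injective (trans i+1≡k (sym t≡k))) i+1≢t
    ...   | tri> _ _ k<i+1 = trans (largestSingletonAt-> k (suc i) k<i+1) (sym (freeBelow-≥ k i (ℕ.s≤s⁻¹ k<i+1)))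

  #freeBelow-suc : ∀ m k → k < m →
    #partitions m (freeBelow (suc k)) ≡ #partitions m (largestSingletonAt k) + #partitions m (freeBelow k)
  #freeBelow-suc m k k<m = trans
    (#partitions-split m (freeBelow (suc k)) t (freeBelow-< (suc k) t (subst (_< suc k) (sym t≡k) (n<1+n k))))
    (cong₂ _+_ (#partitions-cong m
          (updated single (largestSingletonAt k) (largestSingletonAt-≡ k t t≡k) (largestSingletonAt-< k)
              (largestSingletonAt-> k)))
               (#partitions-cong m (updated nonSingle (freeBelow k) (freeBelow-≥ k t (ℕₚ.≤-reflexive (sym t≡k)))
                     (freeBelow-< k) (λ i k<i → freeBelow-≥ k i (<⇒≤ k<i)))))
    where
    t : Fin m
    t = fromℕ< k<m
    t≡k : toℕ t ≡ k
    t≡k = toℕ-fromℕ< k<m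

    updated : ∀ x (c : Fin m → Constraint) → c t ≡ x → (∀ i → toℕ i < k → c i ≡ free) →
      (∀ i → k < toℕ i → c i ≡ nonSingle) →
      ∀ i → updateAt (freeBelow (suc k)) t (λ _ → x) i ≡ c i
    updated x c ct≡x below above i with i ≟ t
    ... | yes refl = trans (updateAt-updates t (freeBelow (suc k))) (sym ct≡x)
    ... | no  i≢t  = trans (updateAt-minimal i t (freeBelow (suc k)) i≢t) (compare (<-cmp (toℕ i) k))
      where
      compare : _ → freeBelow (suc k) i ≡ c i
      compare (tri< i<k _ _) = trans (freeBelow-< (suc k) i (ℕₚ.<-trans i<k (n<1+n k))) (sym (below i i<k))
      compare (tri≈ _ i≡k _) = contradiction (toℕ-injective (trans i≡k (sym t≡k))) i≢t
      compare (tri> _ _ k<i) = trans (freeBelow-≥ (suc k) i k<i) (sym (above i k<i))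

  #tailSingletonFree : ℕ → ℕ → ℕ
  #tailSingletonFree k n = #partitions (n + k) (freeBelow k)

  A≡#tailSingletonFree : ∀ n k → A (n + k) k ≡ #tailSingletonFree k n
  A≡#tailSingletonFree n k = trans (A≡#largestSingletonAt (n + k) k k<) (#largestSingletonAt≡#freeBelow (n + k) k k<)
    where k< = s≤s (m≤n+m k n)

  #tailSingletonFree-suc : ∀ k n →
    #tailSingletonFree (suc k) n ≡ #tailSingletonFree k n + #tailSingletonFree k (suc n)
  #tailSingletonFree-suc k n rewrite +-suc n k = trans (#freeBelow-suc (suc (n + k)) k k<)
    (cong (_+ #tailSingletonFree k (suc n)) (#largestSingletonAt≡#freeBelow (n + k) k k<))
    where k< = s≤s (m≤n+m k n)

  #tailSingletonFree-zero : ∀ k → #tailSingletonFree k 0 ≡ ∑[ j < suc k ] stirling k j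
  #tailSingletonFree-zero k = trans (#partitions-cong k (λ i → freeBelow-< k i (toℕ<n i))) (#partitions-free k)

  -- Falling factorials

  P′-vanishes : ∀ {m j} → m < j → (m P′ j) ≡ 0
  P′-vanishes {m} {suc j} (s≤s m≤j) = cong (_* (m P′ j)) (m≤n⇒m∸n≡0 m≤j)

  *-P′ : ∀ m j → m * (m P′ j) ≡ (m P′ suc j) + j * (m P′ j)
  *-P′ m j with j ≤? m
  ... | yes j≤m = begin
    m * (m P′ j)                          ≡⟨ cong (_* (m P′ j)) (m∸n+n≡m j≤m) ⟨
    (m ∸ j + j) * (m P′ j)                ≡⟨ ℕₚ.*-distribʳ-+ (m P′ j) (m ∸ j) j ⟩
    (m ∸ j) * (m P′ j) + j * (m P′ j)       ∎
  ... | no  j≰m rewrite P′-vanishes (≰⇒> j≰m) | *-zeroʳ m | *-zeroʳ j | *-zeroʳ (m ∸ j) = refl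

  pow≡∑stirling*P′ : ∀ m k → m ^ k ≡ ∑[ j < suc k ] (stirling k j * (m P′ j))
  pow≡∑stirling*P′ m zero    = refl
  pow≡∑stirling*P′ m (suc k) = sym (begin
    ∑[ j < suc (suc k) ] (stirling (suc k) j * (m P′ j))
      ≡⟨⟩
    ∑[ j < suc k ] ((stirling k j + suc j * stirling k (suc j)) * (m P′ suc j))
      ≡⟨ ∑-cong (suc k) (λ j _ → ℕₚ.*-distribʳ-+ (m P′ suc j) (stirling k j) (suc j * stirling k (suc j))) ⟩
    ∑[ j < suc k ] (stirling k j * (m P′ suc j) + suc j * stirling k (suc j) * (m P′ suc j))
      ≡⟨ ∑-distrib-+ (suc k) (λ j → stirling k j * (m P′ suc j)) (λ j → h (suc j)) ⟩
    ∑[ j < suc k ] (stirling k j * (m P′ suc j)) + ∑[ j < suc k ] h (suc j)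
      ≡⟨ cong (∑[ j < suc k ] (stirling k j * (m P′ suc j)) +_) shift ⟩
    ∑[ j < suc k ] (stirling k j * (m P′ suc j)) + ∑[ j < suc k ] h j
      ≡⟨ ∑-distrib-+ (suc k) (λ j → stirling k j * (m P′ suc j)) h ⟨
    ∑[ j < suc k ] (stirling k j * (m P′ suc j) + h j)
      ≡⟨ ∑-cong (suc k) (λ j _ → step j) ⟩
    ∑[ j < suc k ] (m * (stirling k j * (m P′ j)))
      ≡⟨ ∑-distribˡ-* (suc k) m (λ j → stirling k j * (m P′ j)) ⟨
    m * ∑[ j < suc k ] (stirling k j * (m P′ j))
      ≡⟨ cong (m *_) (pow≡∑stirling*P′ m k) ⟨
    m * m ^ k ∎)
    where
    h : ℕ → ℕ
    h j = j * stirling k j * (m P′ j)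

    -- h 0 = 0 and h (suc k) = 0, so shifting the index does not change the sum.
    shift : ∑[ j < suc k ] h (suc j) ≡ ∑[ j < suc k ] h j
    shift = trans (∑-last (suc k) h)
      (trans (cong (λ x → ∑[ j < suc k ] h j + x * (m P′ suc k))
            (trans (cong (suc k *_) (stirling-vanishes (ℕₚ.n<1+n k))) (*-zeroʳ (suc k))))
             (ℕₚ.+-identityʳ _))

    step : ∀ j → stirling k j * (m P′ suc j) + h j ≡ m * (stirling k j * (m P′ j))
    step j = begin
      stirling k j * (m P′ suc j) + j * stirling k j * (m P′ j)
        ≡⟨ factor (stirling k j) (m P′ suc j) j (m P′ j) ⟩
      stirling k j * ((m P′ suc j) + j * (m P′ j))
        ≡⟨ cong (stirling k j *_) (*-P′ m j) ⟨
      stirling k j * (m * (m P′ j))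
        ≡⟨ x[yz]≡y[xz] (stirling k j) m (m P′ j) ⟩
      m * (stirling k j * (m P′ j)) ∎
      where
      factor : ∀ s p j q → s * p + j * s * q ≡ s * (p + j * q)
      factor = solve-∀
      x[yz]≡y[xz] : ∀ x y z → x * (y * z) ≡ y * (x * z)
      x[yz]≡y[xz] = solve-∀

module IntegerCoefficients where

  open import Data.Nat as ℕ using (ℕ; zero; suc; _<_; s≤s)
  import Data.Nat.Properties as ℕₚ
  open import Data.Nat.Combinatorics.Base using (_P′_)
  open import Data.Integer using (ℤ; +_; _+_; _-_; _*_; _^_; 1ℤ)
  import Data.Integer.Properties as ℤₚ
  open import Data.Integer.Tactic.RingSolver using (solve-∀)
  open import Function using (_∘_)
  open import Relation.Binary.PropositionalEquality

  open Combinatorics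
    using (stirling; stirling-vanishes; #tailSingletonFree; #tailSingletonFree-suc; #tailSingletonFree-zero; pow≡∑stirling*P′)
  module ℕΣ = RangeSum ℕₚ.+-*-commutativeSemiring
  open RangeSumRing ℤₚ.+-*-commutativeRing
  open ≡-Reasoning

  +-∑ : ∀ B (f : ℕ → ℕ) → + ℕΣ.∑< B f ≡ ∑[ j < B ] (+ f j)
  +-∑ zero    f = refl
  +-∑ (suc B) f = trans (ℤₚ.pos-+ (f 0) _) (cong (_+_ (+ f 0)) (+-∑ B (f ∘ suc)))

  +-^ : ∀ m k → + (m ℕ.^ k) ≡ (+ m) ^ k
  +-^ m zero    = refl
  +-^ m (suc k) = trans (ℤₚ.pos-* m (m ℕ.^ k)) (cong (+ m *_) (+-^ m k))

  stirling-beyond : ∀ k j → stirling k (suc k ℕ.+ j) ≡ 0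
  stirling-beyond k j = stirling-vanishes (s≤s (ℕₚ.m≤m+n k j))

  coefficient : ℕ → ℕ → ℕ → ℤ
  coefficient zero    k j = + stirling k j
  coefficient (suc n) k j = coefficient n (suc k) j - coefficient n k j

  ∑coefficient≡#tailSingletonFree : ∀ n k B → n ℕ.+ k < B → ∑[ j < B ] coefficient n k j ≡ + #tailSingletonFree k n
  ∑coefficient≡#tailSingletonFree zero    k B k<B = begin
    ∑[ j < B ] (+ stirling k j)             ≡⟨ +-∑ B (stirling k) ⟨
    + ℕΣ.∑< B (stirling k)                   ≡⟨ cong +_ (ℕΣ.∑-extend (stirling k) k<B (stirling-beyond k)) ⟩
    + ℕΣ.∑< (suc k) (stirling k)             ≡⟨ cong +_ (#tailSingletonFree-zero k) ⟨
    + #tailSingletonFree k 0                 ∎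
  ∑coefficient≡#tailSingletonFree (suc n) k B n+k<B = begin
    ∑[ j < B ] (coefficient n (suc k) j - coefficient n k j)
      ≡⟨ ∑-distrib-- B (coefficient n (suc k)) (coefficient n k) ⟩
    ∑< B (coefficient n (suc k)) - ∑< B (coefficient n k)
      ≡⟨ cong₂ _-_ (∑coefficient≡#tailSingletonFree n (suc k) B (subst (_< B) (sym (ℕₚ.+-suc n k)) n+k<B))
                   (∑coefficient≡#tailSingletonFree n k B (ℕₚ.<-trans (ℕₚ.n<1+n _) n+k<B)) ⟩
    + #tailSingletonFree (suc k) n - + #tailSingletonFree k n
      ≡⟨ cong (λ x → + x - + #tailSingletonFree k n) (#tailSingletonFree-suc k n) ⟩
    + (#tailSingletonFree k n ℕ.+ #tailSingletonFree k (suc n)) - + #tailSingletonFree k n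
      ≡⟨ cong (_- + #tailSingletonFree k n) (ℤₚ.pos-+ (#tailSingletonFree k n) _) ⟩
    + #tailSingletonFree k n + + #tailSingletonFree k (suc n) - + #tailSingletonFree k n
      ≡⟨ cancel (+ #tailSingletonFree k n) _ ⟩
    + #tailSingletonFree k (suc n) ∎
    where
    cancel : ∀ x y → x + y - x ≡ y
    cancel = solve-∀

  pow*pow≡∑coefficient : ∀ n k B m → n ℕ.+ k < B →
    (+ m) ^ k * (+ m - 1ℤ) ^ n ≡ ∑[ j < B ] (coefficient n k j * + (m P′ j))
  pow*pow≡∑coefficient zero k B m k<B = begin
    (+ m) ^ k * 1ℤ
      ≡⟨ ℤₚ.*-identityʳ _ ⟩
    (+ m) ^ k
      ≡⟨ +-^ m k ⟨
    + (m ℕ.^ k)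
      ≡⟨ cong +_ (pow≡∑stirling*P′ m k) ⟩
    + ℕΣ.∑< (suc k) (λ j → stirling k j ℕ.* (m P′ j))
      ≡⟨ cong +_ (ℕΣ.∑-extend _ k<B (λ j → cong (ℕ._* (m P′ (suc k ℕ.+ j))) (stirling-beyond k j))) ⟨
    + ℕΣ.∑< B (λ j → stirling k j ℕ.* (m P′ j))
      ≡⟨ +-∑ B _ ⟩
    ∑[ j < B ] (+ (stirling k j ℕ.* (m P′ j)))
      ≡⟨ ∑-cong B (λ j _ → ℤₚ.pos-* (stirling k j) (m P′ j)) ⟩
    ∑[ j < B ] (+ stirling k j * + (m P′ j)) ∎
  pow*pow≡∑coefficient (suc n) k B m n+k<B = begin
    x ^ k * ((x - 1ℤ) * y)
      ≡⟨ expand x (x ^ k) y ⟩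
    x * x ^ k * y - x ^ k * y
      ≡⟨ cong₂ _-_ (pow*pow≡∑coefficient n (suc k) B m (subst (_< B) (sym (ℕₚ.+-suc n k)) n+k<B))
                   (pow*pow≡∑coefficient n k B m (ℕₚ.<-trans (ℕₚ.n<1+n _) n+k<B)) ⟩
    ∑[ j < B ] (coefficient n (suc k) j * + (m P′ j)) - ∑[ j < B ] (coefficient n k j * + (m P′ j))
      ≡⟨ ∑-distrib-- B _ _ ⟨
    ∑[ j < B ] (coefficient n (suc k) j * + (m P′ j) - coefficient n k j * + (m P′ j))
      ≡⟨ ∑-cong B (λ j _ → factor (coefficient n (suc k) j) (coefficient n k j) (+ (m P′ j))) ⟩
    ∑[ j < B ] ((coefficient n (suc k) j - coefficient n k j) * + (m P′ j)) ∎
    where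
    x = + m
    y = (x - 1ℤ) ^ n
    expand : ∀ x p y → p * ((x - 1ℤ) * y) ≡ x * p * y - p * y
    expand = solve-∀
    factor : ∀ a b c → a * c - b * c ≡ (a - b) * c
    factor = solve-∀

module RationalSeries where

  open import Data.Nat as ℕ using (ℕ; zero; suc; NonZero; _!; _∸_; z≤n; _≤?_)
  import Data.Nat.Properties as ℕₚ
  open import Data.Nat.Properties using (_!≢0)
  open import Data.Nat.Combinatorics.Base using (_P′_)
  open import Data.Nat.Combinatorics.Specification using (nP′k≡n!/[n∸k]!; [n∸k]!k!∣n!)
  open import Data.Nat.DivMod using (m/n*n≡m)
  open import Data.Nat.Divisibility using (∣-trans; m∣m*n)
  open import Data.Integer as ℤ using (ℤ; +_; -[1+_])
  import Data.Integer.Properties as ℤₚ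
  open import Data.Integer.Tactic.RingSolver using (solve-∀)
  open import Data.Rational as ℚ using (ℚ; _/_; toℚᵘ; 0ℚ; 1ℚ; _+_; _*_; _-_; -_; ∣_∣; _≤_; _<_)
  import Data.Rational.Properties as ℚₚ
  open import Data.Rational.Solver using (module +-*-Solver)
  open import Data.Rational.Unnormalised as ℚᵘ using (mkℚᵘ; *≡*; *≤*)
  import Data.Rational.Unnormalised.Properties as ℚᵘₚ
  open import Algebra.Properties.Ring ℚₚ.+-*-ring using (x[y-z]≈xy-xz)
  open import Data.Product using (∃; _,_)
  open import Function using (_∘_)
  open import Relation.Binary.PropositionalEquality
  open import Relation.Nullary using (yes; no)

  open Combinatorics using (P′-vanishes; #tailSingletonFree; A≡#tailSingletonFree)
  open IntegerCoefficients using (coefficient; pow*pow≡∑coefficient; ∑coefficient≡#tailSingletonFree; +-∑)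
  module ℕΣ = RangeSum ℕₚ.+-*-commutativeSemiring
  module ℤΣ = RangeSumRing ℤₚ.+-*-commutativeRing
  open RangeSumRing ℚₚ.+-*-commutativeRing

  ι : ℤ → ℚ
  ι x = x / 1

  toℚᵘ-/ : ∀ x D .{{_ : NonZero D}} → toℚᵘ (x / D) ℚᵘ.≃ mkℚᵘ x (ℕ.pred D)
  toℚᵘ-/ x (suc D) = ℚₚ.toℚᵘ-fromℚᵘ (mkℚᵘ x D)

  -- Each identity below is checked on the unnormalised representatives, where it is an identity in ℤ.
  private
    via-ℚᵘ : ∀ {p q r s} → toℚᵘ p ℚᵘ.≃ r → toℚᵘ q ℚᵘ.≃ s → r ℚᵘ.≃ s → p ≡ q
    via-ℚᵘ p≃r q≃s r≃s = ℚₚ.toℚᵘ-injective (ℚᵘₚ.≃-trans p≃r (ℚᵘₚ.≃-trans r≃s (ℚᵘₚ.≃-sym q≃s)))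

  /-as-* : ∀ x D .{{_ : NonZero D}} → x / D ≡ ι x * (+ 1 / D)
  /-as-* x (suc D) = via-ℚᵘ (toℚᵘ-/ x (suc D))
    (ℚᵘₚ.≃-trans (ℚₚ.toℚᵘ-homo-* (ι x) (+ 1 / suc D)) (ℚᵘₚ.*-cong (toℚᵘ-/ x 1) (toℚᵘ-/ (+ 1) (suc D))))
    (*≡* (identity x (+ suc D)))
    where
    identity : ∀ x d → x ℤ.* (+ 1 ℤ.* d) ≡ (x ℤ.* + 1) ℤ.* d
    identity = solve-∀

  ι-+ : ∀ x y → ι (x ℤ.+ y) ≡ ι x + ι y
  ι-+ x y = via-ℚᵘ (toℚᵘ-/ (x ℤ.+ y) 1)
    (ℚᵘₚ.≃-trans (ℚₚ.toℚᵘ-homo-+ (ι x) (ι y)) (ℚᵘₚ.+-cong (toℚᵘ-/ x 1) (toℚᵘ-/ y 1)))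
    (*≡* (identity x y))
    where
    identity : ∀ x y → (x ℤ.+ y) ℤ.* (+ 1 ℤ.* + 1) ≡ (x ℤ.* + 1 ℤ.+ y ℤ.* + 1) ℤ.* + 1
    identity = solve-∀

  ι-* : ∀ x y → ι (x ℤ.* y) ≡ ι x * ι y
  ι-* x y = via-ℚᵘ (toℚᵘ-/ (x ℤ.* y) 1)
    (ℚᵘₚ.≃-trans (ℚₚ.toℚᵘ-homo-* (ι x) (ι y)) (ℚᵘₚ.*-cong (toℚᵘ-/ x 1) (toℚᵘ-/ y 1)))
    (*≡* (identity x y))
    where
    identity : ∀ x y → (x ℤ.* y) ℤ.* (+ 1 ℤ.* + 1) ≡ (x ℤ.* y) ℤ.* + 1
    identity = solve-∀

  ι-neg : ∀ x → ι (ℤ.- x) ≡ ℚ.- ι x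
  ι-neg x = via-ℚᵘ (toℚᵘ-/ (ℤ.- x) 1) (ℚᵘₚ.≃-trans (ℚₚ.toℚᵘ-homo‿- (ι x)) (ℚᵘₚ.-‿cong (toℚᵘ-/ x 1))) (*≡* refl)

  ι-∣∣ : ∀ x → ∣ ι x ∣ ≡ ι (+ ℤ.∣ x ∣)
  ι-∣∣ (+ n)    = ℚₚ.0≤p⇒∣p∣≡p (ℚₚ.nonNegative⁻¹ (ι (+ n)) {{ℚₚ.normalize-nonNeg n 1}})
  ι-∣∣ -[1+ n ] = trans (cong ∣_∣ (ι-neg (+ suc n))) (trans (ℚₚ.∣-p∣≡∣p∣ (ι (+ suc n))) (ι-∣∣ (+ suc n)))

  ι-mono-≤ : ∀ {a b} → a ℕ.≤ b → ι (+ a) ℚ.≤ ι (+ b)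
  ι-mono-≤ {a} {b} a≤b = ℚₚ.toℚᵘ-cancel-≤
    (ℚᵘₚ.≤-respˡ-≃ (ℚᵘₚ.≃-sym (toℚᵘ-/ (+ a) 1)) (ℚᵘₚ.≤-respʳ-≃ (ℚᵘₚ.≃-sym (toℚᵘ-/ (+ b) 1))
      (*≤* (subst₂ ℤ._≤_ (sym (ℤₚ.*-identityʳ (+ a))) (sym (ℤₚ.*-identityʳ (+ b))) (ℤ.+≤+ a≤b)))))

  ι-cancel : ∀ a b D .{{_ : NonZero a}} .{{_ : NonZero b}} .{{_ : NonZero D}} → a ℕ.* b ≡ D →
    ι (+ a) * (+ 1 / D) ≡ + 1 / b
  ι-cancel (suc a) (suc b) D refl = via-ℚᵘ
    (ℚᵘₚ.≃-trans (ℚₚ.toℚᵘ-homo-* (ι (+ suc a)) (+ 1 / (suc a ℕ.* suc b)))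
                 (ℚᵘₚ.*-cong (toℚᵘ-/ (+ suc a) 1) (toℚᵘ-/ (+ 1) (suc a ℕ.* suc b))))
    (toℚᵘ-/ (+ 1) (suc b))
    (*≡* (trans (identity (+ suc a) (+ suc b)) (cong (λ d → + 1 ℤ.* (+ 1 ℤ.* d)) (sym (ℤₚ.pos-* (suc a) (suc b))))))
    where
    identity : ∀ a b → (a ℤ.* + 1) ℤ.* b ≡ + 1 ℤ.* (+ 1 ℤ.* (a ℤ.* b))
    identity = solve-∀

  Σ<≡∑ : ∀ N f → Σ< N f ≡ ∑< N f
  Σ<≡∑ zero    f = refl
  Σ<≡∑ (suc N) f = trans (cong (_+ f N) (Σ<≡∑ N f)) (sym (∑-last N f))

  ι-∑ : ∀ B (f : ℕ → ℤ) → ι (ℤΣ.∑< B f) ≡ ∑[ j < B ] ι (f j)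
  ι-∑ zero    f = refl
  ι-∑ (suc B) f = trans (ι-+ (f 0) _) (cong (_+_ (ι (f 0))) (ι-∑ B (f ∘ suc)))

  suc-pred : ∀ k .{{_ : NonZero k}} → suc (ℕ.pred k) ≡ k
  suc-pred (suc k) = refl

  !-mono-≤ : ∀ {m n} → m ℕ.≤ n → m ! ℕ.≤ n !
  !-mono-≤ {n = zero}  z≤n = ℕₚ.≤-refl
  !-mono-≤ {m} {suc n} m≤n+1 with m ≤? n
  ... | yes m≤n = ℕₚ.≤-trans (!-mono-≤ m≤n) (ℕₚ.m≤m+n (n !) (n ℕ.* n !))
  ... | no  m≰n rewrite ℕₚ.≤-antisym m≤n+1 (ℕₚ.≰⇒> m≰n) = ℕₚ.≤-refl

  invFact-nonNeg : ∀ m → 0ℚ ≤ invFact m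
  invFact-nonNeg m = ℚₚ.nonNegative⁻¹ (invFact m) {{ℚₚ.normalize-nonNeg 1 (m !) {{m !≢0}}}}

  invFact-antitone : ∀ {m n} → m ℕ.≤ n → invFact n ≤ invFact m
  invFact-antitone {m} {n} m≤n = ℚₚ.toℚᵘ-cancel-≤ (ℚᵘₚ.≤-respˡ-≃ (ℚᵘₚ.≃-sym (toℚᵘ-/ (+ 1) (n !) {{n !≢0}}))
    (ℚᵘₚ.≤-respʳ-≃ (ℚᵘₚ.≃-sym (toℚᵘ-/ (+ 1) (m !) {{m !≢0}}))
        (ℚᵘ.*≤* (subst₂ ℤ._≤_ (sym (ℤₚ.*-identityˡ _)) (sym (ℤₚ.*-identityˡ _))
      (ℤ.+≤+ (subst₂ ℕ._≤_ (sym (suc-pred (m !) {{m !≢0}})) (sym (suc-pred (n !) {{n !≢0}})) (!-mono-≤ m≤n)))))))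

  P′*!≡! : ∀ {m j} → j ℕ.≤ m → (m P′ j) ℕ.* (m ∸ j) ! ≡ m !
  P′*!≡! {m} {j} j≤m = trans (cong (ℕ._* (m ∸ j) !) (nP′k≡n!/[n∸k]! j≤m))
    (m/n*n≡m {{(m ∸ j) !≢0}} (∣-trans (m∣m*n (j !)) ([n∸k]!k!∣n! j≤m)))

  P′*invFact : ∀ {m j} → j ℕ.≤ m → ι (+ (m P′ j)) * invFact m ≡ invFact (m ∸ j)
  P′*invFact {m} {j} j≤m = ι-cancel (m P′ j) ((m ∸ j) !) (m !)
    {{ℕₚ.m*n≢0⇒m≢0 (m P′ j) {{subst NonZero (sym (P′*!≡! j≤m)) (m !≢0)}}}} {{(m ∸ j) !≢0}} {{m !≢0}} (P′*!≡! j≤m)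

  ∑P′*invFact : ∀ j N → ∑[ m < N ] (ι (+ (m P′ j)) * invFact m) ≡ ∑< (N ∸ j) invFact
  ∑P′*invFact j N with j ≤? N
  ... | yes j≤N = begin
    ∑[ m < N ] f m                                  ≡⟨ cong (λ n → ∑< n f) (ℕₚ.m+[n∸m]≡n j≤N) ⟨
    ∑< (j ℕ.+ (N ∸ j)) f                            ≡⟨ ∑-split j (N ∸ j) f ⟩
    ∑< j f + ∑[ i < N ∸ j ] f (j ℕ.+ i)             ≡⟨ cong₂ _+_ (∑-zero j (λ m m<j → vanish m<j))
      (∑-cong (N ∸ j) (λ i _ → shifted i)) ⟩
    0ℚ + ∑< (N ∸ j) invFact                         ≡⟨ ℚₚ.+-identityˡ _ ⟩
    ∑< (N ∸ j) invFact                              ∎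
    where
    open ≡-Reasoning
    f : ℕ → ℚ
    f m = ι (+ (m P′ j)) * invFact m
    vanish : ∀ {m} → m ℕ.< j → f m ≡ 0ℚ
    vanish {m} m<j = trans (cong (λ x → ι (+ x) * invFact m) (P′-vanishes m<j)) (ℚₚ.*-zeroˡ (invFact m))
    shifted : ∀ i → f (j ℕ.+ i) ≡ invFact i
    shifted i = trans (P′*invFact (ℕₚ.m≤m+n j i)) (cong invFact (ℕₚ.m+n∸m≡n j i))
  ... | no  j≰N = trans (∑-zero N
      (λ m m<N → trans (cong (λ x → ι (+ x) * invFact m) (P′-vanishes (ℕₚ.<-trans m<N (ℕₚ.≰⇒> j≰N))))
          (ℚₚ.*-zeroˡ (invFact m))))
    (cong (λ n → ∑< n invFact) (sym (ℕₚ.m≤n⇒m∸n≡0 (ℕₚ.<⇒≤ (ℕₚ.≰⇒> j≰N)))))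

  ∑-triangle : ∀ B (f : ℕ → ℚ) → ∣ ∑< B f ∣ ≤ ∑[ j < B ] ∣ f j ∣
  ∑-triangle zero    f = ℚₚ.≤-refl
  ∑-triangle (suc B) f = ℚₚ.≤-trans (ℚₚ.∣p+q∣≤∣p∣+∣q∣ (f 0) _) (ℚₚ.+-monoʳ-≤ ∣ f 0 ∣ (∑-triangle B (f ∘ suc)))

  ∑-mono-≤ : ∀ B {f g : ℕ → ℚ} → (∀ j → j ℕ.< B → f j ≤ g j) → ∑< B f ≤ ∑< B g
  ∑-mono-≤ zero    f≤g = ℚₚ.≤-refl
  ∑-mono-≤ (suc B) f≤g = ℚₚ.+-mono-≤ (f≤g 0 ℕ.z<s) (∑-mono-≤ B (λ j j<B → f≤g (suc j) (ℕ.s<s j<B)))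

  ∑-const : ∀ B w → ∑[ j < B ] w ≡ ι (+ B) * w
  ∑-const zero    w = sym (ℚₚ.*-zeroˡ w)
  ∑-const (suc B) w = begin
    w + ∑[ j < B ] w          ≡⟨ cong₂ _+_ (sym (ℚₚ.*-identityˡ w)) (∑-const B w) ⟩
    1ℚ * w + ι (+ B) * w      ≡⟨ ℚₚ.*-distribʳ-+ w 1ℚ (ι (+ B)) ⟨
    (1ℚ + ι (+ B)) * w        ≡⟨ cong (_* w) (ι-+ (+ 1) (+ B)) ⟨
    ι (+ suc B) * w           ∎
    where open ≡-Reasoning

  invFact-tail : ∀ {j B N} → j ℕ.≤ B → B ℕ.≤ N → ∣ ∑< (N ∸ j) invFact - ∑< N invFact ∣ ≤ ι (+ B) * invFact (N ∸ B)
  invFact-tail {j} {B} {N} j≤B B≤N = begin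
    ∣ ∑< M invFact - ∑< N invFact ∣              ≡⟨ cong (λ n → ∣ ∑< M invFact - ∑< n invFact ∣) (ℕₚ.m∸n+n≡m j≤N) ⟨
    ∣ ∑< M invFact - ∑< (M ℕ.+ j) invFact ∣      ≡⟨ cong (λ x → ∣ ∑< M invFact - x ∣) (∑-split M j invFact) ⟩
    ∣ ∑< M invFact - (∑< M invFact + tail) ∣     ≡⟨ cong ∣_∣ (difference (∑< M invFact) tail) ⟩
    ∣ - tail ∣                                   ≡⟨ ℚₚ.∣-p∣≡∣p∣ tail ⟩
    ∣ tail ∣                                     ≡⟨ ℚₚ.0≤p⇒∣p∣≡p tail-nonNeg ⟩
    tail                                         ≤⟨ ∑-mono-≤ j
      (λ i _ → invFact-antitone (ℕₚ.≤-trans (ℕₚ.∸-monoʳ-≤ N j≤B) (ℕₚ.m≤m+n M i))) ⟩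
    ∑[ i < j ] invFact (N ∸ B)                   ≡⟨ ∑-const j (invFact (N ∸ B)) ⟩
    ι (+ j) * invFact (N ∸ B)                    ≤⟨ ℚₚ.*-monoʳ-≤-nonNeg (invFact (N ∸ B))
      {{ℚ.nonNegative (invFact-nonNeg (N ∸ B))}} (ι-mono-≤ j≤B) ⟩
    ι (+ B) * invFact (N ∸ B)                    ∎
    where
    open ℚₚ.≤-Reasoning
    M = N ∸ j
    j≤N = ℕₚ.≤-trans j≤B B≤N
    tail = ∑[ i < j ] invFact (M ℕ.+ i)
    tail-nonNeg : 0ℚ ≤ tail
    tail-nonNeg = ℚₚ.≤-trans (ℚₚ.≤-reflexive (sym (∑-zero j (λ _ _ → refl))))
      (∑-mono-≤ j (λ i _ → invFact-nonNeg (M ℕ.+ i)))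
    difference : ∀ a t → a - (a + t) ≡ - t
    difference = solve 2 (λ a t → a :- (a :+ t) := :- t) refl
      where open +-*-Solver

  n≤n! : ∀ n → n ℕ.≤ n !
  n≤n! zero    = z≤n
  n≤n! (suc n) = ℕₚ.m≤m*n (suc n) (n !) {{n !≢0}}

  -- R / d! < ε as soon as R · (denominator of ε) < d, since d ≤ d!.
  invFact-archimedean : ∀ R ε → 0ℚ < ε → ∃ λ d₀ → ∀ d → d₀ ℕ.≤ d → ι (+ R) * invFact d < ε
  invFact-archimedean R ε@(ℚ.mkℚ (ℤ.+[1+ p ]) den _) _ = suc (R ℕ.* suc den) , λ d d₀≤d →
    subst (_< ε) (/-as-* (+ R) (d !) {{d !≢0}})
      (ℚₚ.toℚᵘ-cancel-< (ℚᵘₚ.<-respˡ-≃ (ℚᵘₚ.≃-sym (toℚᵘ-/ (+ R) (d !) {{d !≢0}})) (ℚᵘ.*<* (cross-multiplied d d₀≤d))))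
    where
    cross-multiplied : ∀ d → suc (R ℕ.* suc den) ℕ.≤ d → + R ℤ.* + suc den ℤ.< ℤ.+[1+ p ] ℤ.* + suc (ℕ.pred (d !))
    cross-multiplied d d₀≤d = subst₂ ℤ._<_ (ℤₚ.pos-* R (suc den))
      (trans (ℤₚ.pos-* (suc p) (d !)) (cong (λ q → ℤ.+[1+ p ] ℤ.* + q) (sym (suc-pred (d !) {{d !≢0}}))))
      (ℤ.+<+ (ℕₚ.<-≤-trans d₀≤d (ℕₚ.≤-trans (n≤n! d) (ℕₚ.m≤n*m (d !) (suc p)))))
  invFact-archimedean R (ℚ.mkℚ (+ 0)       _ _) (ℚ.*<* (ℤ.+<+ ()))
  invFact-archimedean R (ℚ.mkℚ ℤ.-[1+ _ ] _ _) (ℚ.*<* ())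

  dobinski-error : ∀ B N (α : ℕ → ℚ) →
    ∑[ m < N ] ∑[ j < B ] (α j * (ι (+ (m P′ j)) * invFact m)) - ∑< B α * ∑< N invFact
      ≡ ∑[ j < B ] (α j * (∑< (N ∸ j) invFact - ∑< N invFact))
  dobinski-error B N α = begin
    ∑[ m < N ] ∑[ j < B ] (α j * (ι (+ (m P′ j)) * invFact m)) - ∑< B α * S
      ≡⟨ cong₂ _-_ (∑-comm N B _) (∑-distribʳ-* B S α) ⟩
    ∑[ j < B ] ∑[ m < N ] (α j * (ι (+ (m P′ j)) * invFact m)) - ∑[ j < B ] (α j * S)
      ≡⟨ cong (_- ∑[ j < B ] (α j * S))
        (∑-cong B (λ j _ → trans (sym (∑-distribˡ-* N (α j) _)) (cong (α j *_) (∑P′*invFact j N)))) ⟩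
    ∑[ j < B ] (α j * ∑< (N ∸ j) invFact) - ∑[ j < B ] (α j * S)
      ≡⟨ ∑-distrib-- B _ _ ⟨
    ∑[ j < B ] (α j * ∑< (N ∸ j) invFact - α j * S)
      ≡⟨ ∑-cong B (λ j _ → sym (x[y-z]≈xy-xz (α j) _ S)) ⟩
    ∑[ j < B ] (α j * (∑< (N ∸ j) invFact - S)) ∎
    where
    open ≡-Reasoning
    S = ∑< N invFact

  ∑-weighted-bound : ∀ B (α x : ℕ → ℚ) W → (∀ j → j ℕ.< B → ∣ x j ∣ ≤ W) →
    ∣ ∑[ j < B ] (α j * x j) ∣ ≤ ∑[ j < B ] ∣ α j ∣ * W
  ∑-weighted-bound B α x W x≤W = begin
    ∣ ∑[ j < B ] (α j * x j) ∣     ≤⟨ ∑-triangle B _ ⟩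
    ∑[ j < B ] ∣ α j * x j ∣       ≤⟨ ∑-mono-≤ B (λ j j<B → ℚₚ.≤-trans (ℚₚ.≤-reflexive (ℚₚ.∣p*q∣≡∣p∣*∣q∣ (α j) (x j)))
                                         (ℚₚ.*-monoˡ-≤-nonNeg ∣ α j ∣ {{ℚₚ.∣-∣-nonNeg (α j)}} (x≤W j j<B))) ⟩
    ∑[ j < B ] (∣ α j ∣ * W)       ≡⟨ ∑-distribʳ-* B W (λ j → ∣ α j ∣) ⟨
    ∑[ j < B ] ∣ α j ∣ * W         ∎
    where open ℚₚ.≤-Reasoning

  module Truncation (n k : ℕ) where

    B : ℕ
    B = suc (n ℕ.+ k)

    α : ℕ → ℚ
    α j = ι (coefficient n k j)

    R : ℕ
    R = ℕΣ.∑< B (λ j → ℤ.∣ coefficient n k j ∣)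

    C : ℕ
    C = R ℕ.* B

    term≡∑ : ∀ m → term n k m ≡ ∑[ j < B ] (α j * (ι (+ (m P′ j)) * invFact m))
    term≡∑ m = begin
      term n k m
        ≡⟨ /-as-* ((+ m) ℤ.^ k ℤ.* ((+ m) ℤ.- + 1) ℤ.^ n) (m !) {{m !≢0}} ⟩
      ι ((+ m) ℤ.^ k ℤ.* ((+ m) ℤ.- + 1) ℤ.^ n) * invFact m
        ≡⟨ cong (λ x → ι x * invFact m) (pow*pow≡∑coefficient n k B m ℕₚ.≤-refl) ⟩
      ι (ℤΣ.∑< B (λ j → coefficient n k j ℤ.* + (m P′ j))) * invFact m
        ≡⟨ cong (_* invFact m) (ι-∑ B (λ j → coefficient n k j ℤ.* + (m P′ j))) ⟩
      ∑[ j < B ] ι (coefficient n k j ℤ.* + (m P′ j)) * invFact m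
        ≡⟨ ∑-distribʳ-* B (invFact m) (λ j → ι (coefficient n k j ℤ.* + (m P′ j))) ⟩
      ∑[ j < B ] (ι (coefficient n k j ℤ.* + (m P′ j)) * invFact m)
        ≡⟨ ∑-cong B (λ j _ → trans (cong (_* invFact m) (ι-* (coefficient n k j) (+ (m P′ j))))
            (ℚₚ.*-assoc (α j) _ (invFact m))) ⟩
      ∑[ j < B ] (α j * (ι (+ (m P′ j)) * invFact m)) ∎
      where open ≡-Reasoning

    A≡∑α : + A (n ℕ.+ k) k / 1 ≡ ∑< B α
    A≡∑α = begin
      ι (+ A (n ℕ.+ k) k)             ≡⟨ cong (ι ∘ +_) (A≡#tailSingletonFree n k) ⟩
      ι (+ #tailSingletonFree k n)    ≡⟨ cong ι (∑coefficient≡#tailSingletonFree n k B ℕₚ.≤-refl) ⟨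
      ι (ℤΣ.∑< B (coefficient n k))   ≡⟨ ι-∑ B (coefficient n k) ⟩
      ∑< B α                          ∎
      where open ≡-Reasoning

    ∑∣α∣≡R : ∑[ j < B ] ∣ α j ∣ ≡ ι (+ R)
    ∑∣α∣≡R = trans (∑-cong B (λ j _ → ι-∣∣ (coefficient n k j)))
      (trans (sym (ι-∑ B (λ j → + ℤ.∣ coefficient n k j ∣))) (cong ι (sym (+-∑ B (λ j → ℤ.∣ coefficient n k j ∣)))))

    error-bound : ∀ N → B ℕ.≤ N →
      ∣ Σ< N (term n k) - (+ A (n ℕ.+ k) k / 1) * Σ< N invFact ∣ ≤ ι (+ C) * invFact (N ∸ B)
    error-bound N B≤N = begin
      ∣ Σ< N (term n k) - (+ A (n ℕ.+ k) k / 1) * Σ< N invFact ∣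
        ≡⟨ cong₂ (λ x y → ∣ x - y * Σ< N invFact ∣) (trans (Σ<≡∑ N _) (∑-cong N (λ m _ → term≡∑ m))) A≡∑α ⟩
      ∣ ∑[ m < N ] ∑[ j < B ] (α j * (ι (+ (m P′ j)) * invFact m)) - ∑< B α * Σ< N invFact ∣
        ≡⟨ cong (λ x → ∣ ∑[ m < N ] ∑[ j < B ] (α j * (ι (+ (m P′ j)) * invFact m)) - ∑< B α * x ∣) (Σ<≡∑ N invFact) ⟩
      ∣ ∑[ m < N ] ∑[ j < B ] (α j * (ι (+ (m P′ j)) * invFact m)) - ∑< B α * ∑< N invFact ∣
        ≡⟨ cong ∣_∣ (dobinski-error B N α) ⟩
      ∣ ∑[ j < B ] (α j * (∑< (N ∸ j) invFact - ∑< N invFact)) ∣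
        ≤⟨ ∑-weighted-bound B α _ W (λ j j<B → invFact-tail (ℕₚ.<⇒≤ j<B) B≤N) ⟩
      ∑[ j < B ] ∣ α j ∣ * W
        ≡⟨ cong (_* W) ∑∣α∣≡R ⟩
      ι (+ R) * (ι (+ B) * invFact (N ∸ B))
        ≡⟨ ℚₚ.*-assoc (ι (+ R)) _ _ ⟨
      ι (+ R) * ι (+ B) * invFact (N ∸ B)
        ≡⟨ cong (_* invFact (N ∸ B)) (trans (cong ι (ℤₚ.pos-* R B)) (ι-* (+ R) (+ B))) ⟨
      ι (+ C) * invFact (N ∸ B) ∎
      where
      open ℚₚ.≤-Reasoning
      W = ι (+ B) * invFact (N ∸ B)

open import Data.Nat using (ℕ; _≤_; _+_; _∸_)
open import Data.Integer using (+_)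
open import Data.Rational using (ℚ; 0ℚ; _<_; _-_; _*_; ∣_∣; _/_)
open import Data.Product using (Σ; _,_)
import Data.Nat.Properties as ℕₚ
import Data.Rational.Properties as ℚₚ
open RationalSeries using (module Truncation; invFact-archimedean)

theorem2p2 : (n k : ℕ) (ε : ℚ) → 0ℚ < ε →
    Σ ℕ (λ N₀ → (N : ℕ) → N₀ ≤ N →
    ∣ Σ< N (term n k) - ((+ A (n + k) k) / 1) * Σ< N invFact ∣ < ε)
theorem2p2 n k ε 0<ε =
  let (d₀ , small) = invFact-archimedean C ε 0<ε in
  d₀ + B , λ N d₀+B≤N →
    ℚₚ.≤-<-trans (error-bound N (ℕₚ.m+n≤o⇒n≤o d₀ d₀+B≤N)) (small (N ∸ B) (ℕₚ.m+n≤o⇒m≤o∸n d₀ d₀+B≤N))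
  where open Truncation n k
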